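{- Let $K[x_0,y_0] = K[X,Y]/(F)$, where $F(X,Y) = Y^2 + a_1 XY + a_3 Y - (X^3 + a_2 X^2 + a_4 X + a_6)$. There is an isomorphism of $K$-algebras $\theta : A_f \to \operatorname{Mat}_3(K[x_0,y_0])$ given by \[ x \mapsto \begin{pmatrix} -x_0 - a_2 & -1 & 0 \\ x_0^2 + a_2 x_0 + a_4 & 0 & y_0 \\ y_0 + a_1 x_0 + a_3 & 0 & x_0 \end{pmatrix}, \qquad y \mapsto \begin{pmatrix} 0 & 0 & 0 \\ -a_1 & 0 & -1 \\ 1 & 0 & 0 \end{pmatrix}. \] Moreover $\theta(\xi) = x_0 I_3$ and $\theta(\eta) = y_0 I_3$.
   Context: $K$ is a field of characteristic not 2 or 3, and $a_1,a_2,a_3,a_4,a_6 \in K$ are such that the ternary cubic $f(X,Y,Z) = X^3 F(Z/X, Y/X) = XY^2 + a_1 XYZ + a_3 X^2Y - Z^3 - a_2 XZ^2 - a_4 X^2 Z - a_6 X^3$ defines a smooth plane curve of genus one. $A_f$ is the associative $K$-algebra generated by $x,y$ subject to the relations obtained from the formal identity in $\alpha,\beta$: $f(\alpha,\beta,\alpha x+\beta y)=0$. The central elements are $\xi = (xy)^2 - y^2(x^2 + a_2 x + a_4) - a_1 xy$ and $\eta = \tfrac12(D\xi - a_1\xi - a_3)$, where $D$ is the derivation of $A_f$ given on generators by $Dx = -[xy,x]$, $Dy = -[y,yx]$ (with $[u,v]=uv-vu$); these satisfy $F(\xi,\eta)=0$. (This is the specialisation of the general ternary cubic construction to this $f$.)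 -}

module Defs where

open import Level using (Level; _⊔_) renaming (suc to lsuc)
open import Algebra.Bundles using (CommutativeRing)
open import Algebra.Morphism.Structures using (module RingMorphisms)
open import Data.Product using (Σ; _×_; _,_; proj₁)
open import Data.Fin using (Fin; zero; suc; _≟_)
open import Relation.Nullary using (¬_; yes; no)

record Field (c ℓ : Level) : Set (lsuc (c ⊔ ℓ)) where
  field
    commutativeRing : CommutativeRing c ℓ
  open CommutativeRing commutativeRing public
  field
    1≉0     : ¬ (1# ≈ 0#)
    inverse : ∀ x → ¬ (x ≈ 0#) → Σ Carrier λ y → x * y ≈ 1#

infixl 6 _⊕_ _⊖_
infixl 7 _⊗_
infix  8 ⊝_

data Term {c} (A : Set c) : Set c where
  gx gy : Term A
  con   : A → Term A
  _⊕_   : Term A → Term A → Term A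
  _⊗_   : Term A → Term A → Term A
  ⊝_    : Term A → Term A

_⊖_ : ∀ {c} {A : Set c} → Term A → Term A → Term A
s ⊖ t = s ⊕ (⊝ t)

module WithField {c ℓ} (K : Field c ℓ) where
  open Field K using (Carrier; _≈_; _+_; _*_; 0#; 1#; inverse)

  T : Set c
  T = Term Carrier

  -- The K-algebra presented by generators gx, gy and relations R
  -- (each r with R r is imposed as r = 0): the congruence on terms
  -- generated by the axioms of an associative unital K-algebra (K central)
  -- and the relations.
  infix 4 _∼⟨_⟩_
  data Cong (R : T → Set c) : T → T → Set (c ⊔ ℓ)

  _∼⟨_⟩_ : T → (T → Set c) → T → Set (c ⊔ ℓ)
  s ∼⟨ R ⟩ t = Cong R s t

  data Cong R where
    ∼-refl    : ∀ {t} → t ∼⟨ R ⟩ t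
    ∼-sym     : ∀ {s t} → s ∼⟨ R ⟩ t → t ∼⟨ R ⟩ s
    ∼-trans   : ∀ {s t u} → s ∼⟨ R ⟩ t → t ∼⟨ R ⟩ u → s ∼⟨ R ⟩ u
    ⊕-cong    : ∀ {s s' t t'} → s ∼⟨ R ⟩ s' → t ∼⟨ R ⟩ t' → s ⊕ t ∼⟨ R ⟩ s' ⊕ t'
    ⊗-cong    : ∀ {s s' t t'} → s ∼⟨ R ⟩ s' → t ∼⟨ R ⟩ t' → s ⊗ t ∼⟨ R ⟩ s' ⊗ t'
    ⊝-cong    : ∀ {s s'} → s ∼⟨ R ⟩ s' → ⊝ s ∼⟨ R ⟩ ⊝ s'
    ⊕-assoc   : ∀ {s t u} → (s ⊕ t) ⊕ u ∼⟨ R ⟩ s ⊕ (t ⊕ u)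
    ⊕-comm    : ∀ {s t} → s ⊕ t ∼⟨ R ⟩ t ⊕ s
    ⊕-idʳ     : ∀ {t} → t ⊕ con 0# ∼⟨ R ⟩ t
    ⊕-invʳ    : ∀ {t} → t ⊕ (⊝ t) ∼⟨ R ⟩ con 0#
    ⊗-assoc   : ∀ {s t u} → (s ⊗ t) ⊗ u ∼⟨ R ⟩ s ⊗ (t ⊗ u)
    ⊗-idˡ     : ∀ {t} → con 1# ⊗ t ∼⟨ R ⟩ t
    ⊗-idʳ     : ∀ {t} → t ⊗ con 1# ∼⟨ R ⟩ t
    distribˡ  : ∀ {s t u} → s ⊗ (t ⊕ u) ∼⟨ R ⟩ (s ⊗ t) ⊕ (s ⊗ u)
    distribʳ  : ∀ {s t u} → (t ⊕ u) ⊗ s ∼⟨ R ⟩ (t ⊗ s) ⊕ (u ⊗ s)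
    con-cong  : ∀ {a b} → a ≈ b → con a ∼⟨ R ⟩ con b
    con-+     : ∀ {a b} → con (a + b) ∼⟨ R ⟩ con a ⊕ con b
    con-*     : ∀ {a b} → con (a * b) ∼⟨ R ⟩ con a ⊗ con b
    con-central : ∀ {a t} → con a ⊗ t ∼⟨ R ⟩ t ⊗ con a
    relation  : ∀ {r} → R r → r ∼⟨ R ⟩ con 0#

  Mat : Set c
  Mat = Fin 3 → Fin 3 → T

  scalarMat : T → Mat
  scalarMat t i j with i ≟ j
  ... | yes _ = t
  ... | no  _ = con 0#

  _M+_ : Mat → Mat → Mat
  (A M+ B) i j = A i j ⊕ B i j

  M-_ : Mat → Mat
  (M- A) i j = ⊝ A i j

  _M*_ : Mat → Mat → Mat
  (A M* B) i j = A i zero ⊗ B zero j ⊕ A i (suc zero) ⊗ B (suc zero) j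
                   ⊕ A i (suc (suc zero)) ⊗ B (suc (suc zero)) j

  _≈M⟨_⟩_ : Mat → (T → Set c) → Mat → Set (c ⊔ ℓ)
  A ≈M⟨ R ⟩ B = ∀ i j → A i j ∼⟨ R ⟩ B i j

  mat : T → T → T → T → T → T → T → T → T → Mat
  mat m00 m01 m02 m10 m11 m12 m20 m21 m22 = λ where
    zero zero → m00
    zero (suc zero) → m01
    zero (suc (suc zero)) → m02
    (suc zero) zero → m10
    (suc zero) (suc zero) → m11
    (suc zero) (suc (suc zero)) → m12
    (suc (suc zero)) zero → m20
    (suc (suc zero)) (suc zero) → m21
    (suc (suc zero)) (suc (suc zero)) → m22

  module Weierstrass (a₁ a₂ a₃ a₄ a₆ : Carrier) where

    2# 3# : Carrier
    2# = 1# + 1#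
    3# = 1# + 1# + 1#

    module InRing {c' ℓ'} (L : CommutativeRing c' ℓ') (φ : Carrier → CommutativeRing.Carrier L) where
      open CommutativeRing L renaming (Carrier to C; _+_ to _+'_; _*_ to _*'_; -_ to -'_)
      infixl 6 _-'_
      _-'_ : C → C → C
      u -' v = u +' (-' v)
      fL fX fY fZ : C → C → C → C
      fL X Y Z = X *' Y *' Y +' φ a₁ *' X *' Y *' Z +' φ a₃ *' X *' X *' Y
                 -' Z *' Z *' Z -' φ a₂ *' X *' Z *' Z -' φ a₄ *' X *' X *' Z
                 -' φ a₆ *' X *' X *' X
      fX X Y Z = Y *' Y +' φ a₁ *' Y *' Z +' φ 2# *' φ a₃ *' X *' Y
                 -' φ a₂ *' Z *' Z -' φ 2# *' φ a₄ *' X *' Z -' φ 3# *' φ a₆ *' X *' X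
      fY X Y Z = φ 2# *' X *' Y +' φ a₁ *' X *' Z +' φ a₃ *' X *' X
      fZ X Y Z = φ a₁ *' X *' Y -' φ 3# *' Z *' Z -' φ 2# *' φ a₂ *' X *' Z
                 -' φ a₄ *' X *' X

    -- f = 0 defines a smooth plane curve: over every field extension L of K
    -- there is no point (X:Y:Z) of ℙ²(L) on the curve where all partial
    -- derivatives of f vanish.
    Smooth : Set (lsuc (c ⊔ ℓ))
    Smooth = (L : Field c ℓ) (φ : Carrier → Field.Carrier L) →
             RingMorphisms.IsRingHomomorphism (CommutativeRing.rawRing (Field.commutativeRing K))
                                              (CommutativeRing.rawRing (Field.commutativeRing L)) φ →
             (X Y Z : Field.Carrier L) →
             ¬ (Field._≈_ L X (Field.0# L) × Field._≈_ L Y (Field.0# L) × Field._≈_ L Z (Field.0# L)) →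
             let open InRing (Field.commutativeRing L) φ
                 _≈L_ = Field._≈_ L
                 0L = Field.0# L
             in ¬ (fL X Y Z ≈L 0L × fX X Y Z ≈L 0L × fY X Y Z ≈L 0L × fZ X Y Z ≈L 0L)

    -- Relations of A_f: the coefficients of α³, α²β, αβ², β³ in the formal
    -- expansion of f(α, β, αx + βy) (α, β commuting central indeterminates).
    data RelA : T → Set c where
      rel-α³   : RelA (⊝ (gx ⊗ gx ⊗ gx) ⊖ con a₂ ⊗ (gx ⊗ gx) ⊖ con a₄ ⊗ gx ⊖ con a₆)
      rel-α²β  : RelA (con a₁ ⊗ gx ⊕ con a₃
                       ⊖ (gx ⊗ gx ⊗ gy ⊕ gx ⊗ gy ⊗ gx ⊕ gy ⊗ gx ⊗ gx)
                       ⊖ con a₂ ⊗ (gx ⊗ gy ⊕ gy ⊗ gx) ⊖ con a₄ ⊗ gy)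
      rel-αβ²  : RelA (con 1# ⊕ con a₁ ⊗ gy
                       ⊖ (gx ⊗ gy ⊗ gy ⊕ gy ⊗ gx ⊗ gy ⊕ gy ⊗ gy ⊗ gx)
                       ⊖ con a₂ ⊗ (gy ⊗ gy))
      rel-β³   : RelA (⊝ (gy ⊗ gy ⊗ gy))

    -- K[x₀,y₀] = K[X,Y]/(F): the K-algebra generated by x₀ := gx, y₀ := gy
    -- subject to x₀y₀ = y₀x₀ and F(x₀,y₀) = 0, where
    -- F(X,Y) = Y² + a₁XY + a₃Y − (X³ + a₂X² + a₄X + a₆).
    data RelF : T → Set c where
      rel-comm : RelF (gx ⊗ gy ⊖ gy ⊗ gx)
      rel-F    : RelF (gy ⊗ gy ⊕ con a₁ ⊗ gx ⊗ gy ⊕ con a₃ ⊗ gy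
                       ⊖ (gx ⊗ gx ⊗ gx ⊕ con a₂ ⊗ (gx ⊗ gx) ⊕ con a₄ ⊗ gx ⊕ con a₆))

    _∼A_ : T → T → Set (c ⊔ ℓ)
    s ∼A t = s ∼⟨ RelA ⟩ t

    _≈M_ : Mat → Mat → Set (c ⊔ ℓ)
    A ≈M B = A ≈M⟨ RelF ⟩ B

    x₀ y₀ : T
    x₀ = gx
    y₀ = gy

    θx θy : Mat
    θx = mat (⊝ x₀ ⊖ con a₂)                (⊝ con 1#) (con 0#)
             (x₀ ⊗ x₀ ⊕ con a₂ ⊗ x₀ ⊕ con a₄) (con 0#)   y₀
             (y₀ ⊕ con a₁ ⊗ x₀ ⊕ con a₃)      (con 0#)   x₀
    θy = mat (con 0#)    (con 0#) (con 0#)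
             (⊝ con a₁)  (con 0#) (⊝ con 1#)
             (con 1#)    (con 0#) (con 0#)

    θ : T → Mat
    θ gx      = θx
    θ gy      = θy
    θ (con a) = scalarMat (con a)
    θ (s ⊕ t) = θ s M+ θ t
    θ (s ⊗ t) = θ s M* θ t
    θ (⊝ s)   = M- θ s

    [_,_] : T → T → T
    [ u , v ] = u ⊗ v ⊖ v ⊗ u

    D : T → T
    D gx      = ⊝ [ gx ⊗ gy , gx ]
    D gy      = ⊝ [ gy , gy ⊗ gx ]
    D (con a) = con 0#
    D (s ⊕ t) = D s ⊕ D t
    D (s ⊗ t) = D s ⊗ t ⊕ s ⊗ D t
    D (⊝ s)   = ⊝ D s

    ξ : T
    ξ = (gx ⊗ gy) ⊗ (gx ⊗ gy) ⊖ (gy ⊗ gy) ⊗ (gx ⊗ gx ⊕ con a₂ ⊗ gx ⊕ con a₄)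
        ⊖ con a₁ ⊗ (gx ⊗ gy)

    η : ¬ (2# ≈ 0#) → T
    η char≢2 = con (proj₁ (inverse 2# char≢2)) ⊗ (D ξ ⊖ con a₁ ⊗ ξ ⊖ con a₃)

    -- θ : A_f → Mat₃(K[x₀,y₀]) is a well-defined isomorphism of K-algebras
    -- (it is a K-algebra map on representatives by construction).
    IsIsoθ : Set (c ⊔ ℓ)
    IsIsoθ = (∀ s t → s ∼A t → θ s ≈M θ t)
           × (∀ s t → θ s ≈M θ t → s ∼A t)
           × (∀ (M : Mat) → Σ T λ t → θ t ≈M M)

module Submission where

-- The images θx, θy of the generators satisfy the four relations of A_f, so θ descends to
-- A_f, and θ(ξ) = x₀ I, θ(η) = y₀ I by direct computation. Conversely ξ and η are central
-- in A_f and satisfy F(ξ, η) = 0, so x₀ ↦ ξ, y₀ ↦ η defines σ : K[x₀,y₀] → Z(A_f). The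
-- elements eᵢ₀, e₀ⱼ of A_f which θ sends to the matrix units Eᵢ₀, E₀ⱼ satisfy
-- e₀ⱼ eₖ₀ = δⱼₖ e₀₀ and Σᵢ eᵢ₀ e₀ᵢ = 1, so ψ(M) = Σᵢⱼ σ(Mᵢⱼ) eᵢ₀ e₀ⱼ is a ring homomorphism
-- Mat₃(K[x₀,y₀]) → A_f. It inverts θ: ψ(θ(x)) = x because e₀ᵢ x eⱼ₀ = σ(θ(x)ᵢⱼ) e₀₀, and
-- θ(ψ(M)) = M because θ(eᵢ₀ e₀ⱼ) = Eᵢⱼ.
--
-- The many polynomial identities in A_f and K[x₀,y₀] are verified by normalising
-- noncommutative polynomials with integer coefficients and central variables, rewriting
-- words by the defining relations and 2 · ½ = 1.

open import Level using (_⊔_)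
open import Algebra.Bundles using (Ring)
open import Data.Nat as ℕ using (ℕ; zero; suc)
import Data.Nat.Properties as ℕ
open import Data.Integer as ℤ using (ℤ; +_; -[1+_])
import Data.Integer.Properties as ℤ
open import Data.Sign as Sign using (Sign)
open import Data.Fin using (Fin; zero; suc; toℕ; _≟_)
open import Data.List using (List; []; _∷_; _++_; allFin; cartesianProductWith)
open import Data.Maybe using (Maybe; just; nothing)
open import Data.Maybe.Relation.Unary.All using (All; just; nothing)
open import Data.Product using (_×_; _,_; proj₁; proj₂)
open import Data.Bool using (true; false)
open import Data.Vec using (tabulate; lookup)
open import Data.Vec.Properties using (lookup∘tabulate)
open import Relation.Nullary using (¬_; yes; no)
open import Relation.Binary.Bundles using (Setoid)
open import Relation.Binary.PropositionalEquality as ≡ using (_≡_)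
open import Defs

module Centre {c ℓ} (R : Ring c ℓ) where
  open Ring R
  open import Algebra.Properties.Ring R using (-‿distribˡ-*; -‿distribʳ-*)
  open import Algebra.Properties.Semiring.Exp semiring using (_^_)
  open import Relation.Binary.Reasoning.Setoid setoid

  Commute : Carrier → Carrier → Set ℓ
  Commute x y = x * y ≈ y * x

  Central : Carrier → Set (c ⊔ ℓ)
  Central z = ∀ x → Commute z x

  commute-+ : ∀ {x y z} → Commute x y → Commute x z → Commute x (y + z)
  commute-+ {x} {y} {z} xy xz = begin
    x * (y + z)     ≈⟨ distribˡ x y z ⟩
    x * y + x * z   ≈⟨ +-cong xy xz ⟩
    y * x + z * x   ≈⟨ distribʳ x y z ⟨
    (y + z) * x     ∎

  commute-* : ∀ {x y z} → Commute x y → Commute x z → Commute x (y * z)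
  commute-* {x} {y} {z} xy xz = begin
    x * (y * z) ≈⟨ *-assoc x y z ⟨
    (x * y) * z ≈⟨ *-congʳ xy ⟩
    (y * x) * z ≈⟨ *-assoc y x z ⟩
    y * (x * z) ≈⟨ *-congˡ xz ⟩
    y * (z * x) ≈⟨ *-assoc y z x ⟨
    (y * z) * x ∎

  commute-‿ : ∀ {x y} → Commute x y → Commute x (- y)
  commute-‿ {x} {y} xy = begin
    x * - y   ≈⟨ -‿distribʳ-* x y ⟨
    - (x * y) ≈⟨ -‿cong xy ⟩
    - (y * x) ≈⟨ -‿distribˡ-* y x ⟩
    - y * x   ∎

  central-1# : Central 1#
  central-1# x = trans (*-identityˡ x) (sym (*-identityʳ x))

  central-+ : ∀ {y z} → Central y → Central z → Central (y + z)
  central-+ cy cz x = sym (commute-+ (sym (cy x)) (sym (cz x)))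

  central-* : ∀ {y z} → Central y → Central z → Central (y * z)
  central-* cy cz x = sym (commute-* (sym (cy x)) (sym (cz x)))

  central-‿ : ∀ {z} → Central z → Central (- z)
  central-‿ cz x = sym (commute-‿ (sym (cz x)))

  central-^ : ∀ {z} → Central z → ∀ n → Central (z ^ n)
  central-^ cz zero    = central-1#
  central-^ cz (suc n) = central-* cz (central-^ cz n)

  central-swap : ∀ {z} → Central z → ∀ x y → x * (z * y) ≈ z * (x * y)
  central-swap {z} cz x y = begin
    x * (z * y) ≈⟨ *-assoc x z y ⟨
    (x * z) * y ≈⟨ *-congʳ (cz x) ⟨
    (z * x) * y ≈⟨ *-assoc z x y ⟩
    z * (x * y) ∎

  middle-swap : ∀ {x y} → Commute x y → ∀ w z → (w * x) * (y * z) ≈ (w * y) * (x * z)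
  middle-swap {x} {y} xy w z = begin
    (w * x) * (y * z) ≈⟨ *-assoc w x (y * z) ⟩
    w * (x * (y * z)) ≈⟨ *-congˡ (*-assoc x y z) ⟨
    w * ((x * y) * z) ≈⟨ *-congˡ (*-congʳ xy) ⟩
    w * ((y * x) * z) ≈⟨ *-congˡ (*-assoc y x z) ⟩
    w * (y * (x * z)) ≈⟨ *-assoc w y (x * z) ⟨
    (w * y) * (x * z) ∎

module IntegerMultiples {c ℓ} (R : Ring c ℓ) where
  open Ring R
  open Centre R using (Central)
  open import Algebra.Properties.Ring R
  open import Algebra.Properties.Semiring.Mult semiring
    using (×-homo-+; ×1-homo-*; ×-assoc-*; ×-comm-*; ×-congʳ)
    renaming (_×_ to _·_)
  open import Algebra.Properties.CommutativeSemigroup +-commutativeSemigroup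
    using (interchange)
  open import Relation.Binary.Reasoning.Setoid setoid

  fromℤ : ℤ → Carrier
  fromℤ (+ n)    = n · 1#
  fromℤ -[1+ n ] = - (suc n · 1#)

  fromℤ-⊖ : ∀ m n → fromℤ (m ℤ.⊖ n) ≈ m · 1# - n · 1#
  fromℤ-⊖ m       zero    = sym (trans (+-congˡ -0#≈0#) (+-identityʳ _))
  fromℤ-⊖ zero    (suc n) = sym (+-identityˡ _)
  fromℤ-⊖ (suc m) (suc n) = begin
    fromℤ (suc m ℤ.⊖ suc n)         ≡⟨ ≡.cong fromℤ (ℤ.[1+m]⊖[1+n]≡m⊖n m n) ⟩
    fromℤ (m ℤ.⊖ n)                 ≈⟨ fromℤ-⊖ m n ⟩
    a - b                           ≈⟨ +-identityˡ _ ⟨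
    0# + (a - b)                    ≈⟨ +-congʳ (-‿inverseʳ 1#) ⟨
    (1# - 1#) + (a - b)             ≈⟨ interchange 1# a (- 1#) (- b) ⟨
    (1# + a) + (- 1# + - b)         ≈⟨ +-congˡ (-‿+-comm 1# b) ⟩
    (1# + a) - (1# + b)             ∎
    where a = m · 1#; b = n · 1#

  fromℤ-homo-+ : ∀ i j → fromℤ (i ℤ.+ j) ≈ fromℤ i + fromℤ j
  fromℤ-homo-+ (+ m)    (+ n)    = ×-homo-+ 1# m n
  fromℤ-homo-+ (+ m)    -[1+ n ] = fromℤ-⊖ m (suc n)
  fromℤ-homo-+ -[1+ m ] (+ n)    = trans (fromℤ-⊖ n (suc m)) (+-comm _ _)
  fromℤ-homo-+ -[1+ m ] -[1+ n ] = begin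
    - (suc (suc (m ℕ.+ n)) · 1#)    ≡⟨ ≡.cong (λ k → - (suc k · 1#)) (ℕ.+-suc m n) ⟨
    - ((suc m ℕ.+ suc n) · 1#)      ≈⟨ -‿cong (×-homo-+ 1# (suc m) (suc n)) ⟩
    - (suc m · 1# + suc n · 1#)     ≈⟨ -‿+-comm _ _ ⟨
    - (suc m · 1#) + - (suc n · 1#) ∎

  fromℤ-homo-‿ : ∀ i → fromℤ (ℤ.- i) ≈ - fromℤ i
  fromℤ-homo-‿ (+ zero)  = sym -0#≈0#
  fromℤ-homo-‿ (+ suc n) = refl
  fromℤ-homo-‿ -[1+ n ]  = sym (-‿involutive _)

  private
    ·1-central : ∀ n → Central (n · 1#)
    ·1-central n x = begin
      (n · 1#) * x ≈⟨ ×-assoc-* n 1# x ⟩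
      n · (1# * x) ≈⟨ ×-congʳ n (trans (*-identityˡ x) (sym (*-identityʳ x))) ⟩
      n · (x * 1#) ≈⟨ ×-comm-* n x 1# ⟨
      x * (n · 1#) ∎

  fromℤ-central : ∀ i → Central (fromℤ i)
  fromℤ-central (+ n)    x = ·1-central n x
  fromℤ-central -[1+ n ] x = begin
    - a * x   ≈⟨ -‿distribˡ-* a x ⟨
    - (a * x) ≈⟨ -‿cong (·1-central (suc n) x) ⟩
    - (x * a) ≈⟨ -‿distribʳ-* x a ⟩
    x * - a   ∎
    where a = suc n · 1#

  private
    sgn : Sign → Carrier
    sgn Sign.+ = 1#
    sgn Sign.- = - 1#

    sgn-homo-* : ∀ s t → sgn (s Sign.* t) ≈ sgn s * sgn t
    sgn-homo-* Sign.+ t      = sym (*-identityˡ _)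
    sgn-homo-* Sign.- Sign.+ = sym (*-identityʳ _)
    sgn-homo-* Sign.- Sign.- = begin
      1#           ≈⟨ -‿involutive 1# ⟨
      - - 1#       ≈⟨ -‿cong (-1*x≈-x 1#) ⟨
      - (- 1# * 1#) ≈⟨ -‿distribʳ-* (- 1#) 1# ⟩
      - 1# * - 1#  ∎

    fromℤ-◃ : ∀ s n → fromℤ (s ℤ.◃ n) ≈ sgn s * (n · 1#)
    fromℤ-◃ s      zero    = sym (zeroʳ _)
    fromℤ-◃ Sign.+ (suc n) = sym (*-identityˡ _)
    fromℤ-◃ Sign.- (suc n) = sym (-1*x≈-x _)

    fromℤ-sign-abs : ∀ i → fromℤ i ≈ sgn (ℤ.sign i) * (ℤ.∣ i ∣ · 1#)
    fromℤ-sign-abs (+ n)    = sym (*-identityˡ _)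
    fromℤ-sign-abs -[1+ n ] = sym (-1*x≈-x _)

  fromℤ-homo-* : ∀ i j → fromℤ (i ℤ.* j) ≈ fromℤ i * fromℤ j
  fromℤ-homo-* i j = begin
    fromℤ (i ℤ.* j)                    ≈⟨ fromℤ-◃ (s Sign.* t) (m ℕ.* n) ⟩
    sgn (s Sign.* t) * ((m ℕ.* n) · 1#) ≈⟨ *-cong (sgn-homo-* s t) (×1-homo-* m n) ⟩
    (sgn s * sgn t) * (a * b)          ≈⟨ *-assoc _ _ _ ⟩
    sgn s * (sgn t * (a * b))          ≈⟨ *-congˡ (*-assoc _ _ _) ⟨
    sgn s * ((sgn t * a) * b)          ≈⟨ *-congˡ (*-congʳ (·1-central m (sgn t))) ⟨
    sgn s * ((a * sgn t) * b)          ≈⟨ *-congˡ (*-assoc _ _ _) ⟩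
    sgn s * (a * (sgn t * b))          ≈⟨ *-assoc _ _ _ ⟨
    (sgn s * a) * (sgn t * b)          ≈⟨ *-cong (fromℤ-sign-abs i) (fromℤ-sign-abs j) ⟨
    fromℤ i * fromℤ j                  ∎
    where
    s = ℤ.sign i; t = ℤ.sign j; m = ℤ.∣ i ∣; n = ℤ.∣ j ∣
    a = m · 1#; b = n · 1#

tabulate²-injective : ∀ {a} {A : Set a} {m n} {f g : Fin m → Fin n → A} →
  tabulate (λ i → tabulate (f i)) ≡ tabulate (λ i → tabulate (g i)) → ∀ i j → f i j ≡ g i j
tabulate²-injective {f = f} {g} eq i j = begin
  f i j                                                 ≡⟨ entry f ⟨
  lookup (lookup (tabulate (λ i → tabulate (f i))) i) j ≡⟨ ≡.cong (λ M → lookup (lookup M i) j) eq ⟩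
  lookup (lookup (tabulate (λ i → tabulate (g i))) i) j ≡⟨ entry g ⟩
  g i j                                                 ∎
  where
  open ≡.≡-Reasoning
  entry : ∀ h → lookup (lookup (tabulate (λ i → tabulate (h i))) i) j ≡ h i j
  entry h = ≡.trans (≡.cong (λ v → lookup v j) (lookup∘tabulate (λ i → tabulate (h i)) i))
                    (lookup∘tabulate (h i) j)

infixl 6 _:+_ _:−_
infixl 7 _:*_
infix  8 :-_

data Expr : Set where
  cvar gen  : ℕ → Expr
  one zer   : Expr
  _:+_ _:*_ : Expr → Expr → Expr
  :-_       : Expr → Expr

_:−_ : Expr → Expr → Expr
a :− b = a :+ :- b

Word Exponents : Set
Word      = List ℕ
Exponents = List ℕ

-- (k , w , p) stands for k · ζ₀^p₀ ζ₁^p₁ ⋯ · w, with ζᵢ the central variables.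
Monomial Polynomial : Set
Monomial   = ℤ × Word × Exponents
Polynomial = List Monomial

data Comparison {A : Set} (x y : A) : Set where
  before after : Comparison x y
  same         : x ≡ y → Comparison x y

compareℕ : (m n : ℕ) → Comparison m n
compareℕ m n with m ℕ.≟ n | n ℕ.<ᵇ m
... | yes m≡n | _     = same m≡n
... | no _    | true  = before
... | no _    | false = after

compareLex : (u v : List ℕ) → Comparison u v
compareLex []      []      = same ≡.refl
compareLex []      (_ ∷ _) = after
compareLex (_ ∷ _) []      = before
compareLex (a ∷ u) (b ∷ v) with compareℕ a b
... | before = before
... | after  = after
... | same ≡.refl with compareLex u v
...   | before = before
...   | after  = after
...   | same ≡.refl = same ≡.refl

_⊞_ : Exponents → Exponents → Exponents
[]      ⊞ q       = q
(a ∷ p) ⊞ []      = a ∷ p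
(a ∷ p) ⊞ (b ∷ q) = a ℕ.+ b ∷ p ⊞ q

unitExponents : ℕ → Exponents
unitExponents zero    = 1 ∷ []
unitExponents (suc i) = 0 ∷ unitExponents i

-- Polynomials are sorted by a weighted degree-lexicographic order, largest monomial first.
-- Reduction with a list of rules only reaches 0 when every rule rewrites its word into
-- smaller ones.
module Polynomials (weight : ℕ → ℕ) where

  degree : Word → ℕ
  degree []      = 0
  degree (a ∷ w) = weight a ℕ.+ degree w

  compareKey : ∀ (k l : Word × Exponents) → Comparison k l
  compareKey (u , p) (v , q) with compareℕ (degree u) (degree v)
  ... | before = before
  ... | after  = after
  ... | same _ with compareLex u v
  ...   | before = before
  ...   | after  = after
  ...   | same ≡.refl with compareLex p q
  ...     | before = before
  ...     | after  = after
  ...     | same ≡.refl = same ≡.refl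

  key : Monomial → Word × Exponents
  key (_ , K) = K

  infixl 6 _⊕ₚ_
  infixl 7 _⊗ₚ_ _*ₘ_

  _⊕ₚ_     : Polynomial → Polynomial → Polynomial
  insert   : Monomial → Polynomial → Polynomial → Polynomial
  insertBy : ∀ m → Polynomial → ∀ n → Polynomial → Comparison (key m) (key n) → Polynomial
  []      ⊕ₚ q = q
  (m ∷ p) ⊕ₚ q = insert m p q
  insert m p []       = m ∷ p
  insert m p (n ∷ q)  = insertBy m p n q (compareKey (key m) (key n))
  insertBy m p n q before = m ∷ insert n q p
  insertBy m p n q after  = n ∷ insert m p q
  insertBy (k , K) p (l , _) q (same _) with k ℤ.+ l ℤ.≟ + 0
  ... | yes _ = p ⊕ₚ q
  ... | no _  = (k ℤ.+ l , K) ∷ p ⊕ₚ q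

  _*ₘ_ : Monomial → Monomial → Monomial
  (k , u , p) *ₘ (l , v , q) = k ℤ.* l , u ++ v , p ⊞ q

  scale : Monomial → Polynomial → Polynomial
  scale m []      = []
  scale m (n ∷ q) = m *ₘ n ∷ scale m q

  _⊗ₚ_ : Polynomial → Polynomial → Polynomial
  []      ⊗ₚ q = []
  (m ∷ p) ⊗ₚ q = scale m q ⊕ₚ p ⊗ₚ q

  ⊝ₚ_ : Polynomial → Polynomial
  ⊝ₚ []            = []
  ⊝ₚ ((k , K) ∷ p) = (ℤ.- k , K) ∷ ⊝ₚ p

  normalise : Expr → Polynomial
  normalise (cvar i) = (+ 1 , [] , unitExponents i) ∷ []
  normalise (gen a)  = (+ 1 , a ∷ [] , []) ∷ []
  normalise one      = (+ 1 , [] , []) ∷ []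
  normalise zer      = []
  normalise (a :+ b) = normalise a ⊕ₚ normalise b
  normalise (a :* b) = normalise a ⊗ₚ normalise b
  normalise (:- a)   = ⊝ₚ normalise a

  _·ʷ_ : Polynomial → Word → Polynomial
  []                ·ʷ v = []
  ((k , u , p) ∷ q) ·ʷ v = (k , u ++ v , p) ∷ q ·ʷ v

  stripPrefix : Word → Word → Maybe Word
  stripPrefix []      w       = just w
  stripPrefix (_ ∷ _) []      = nothing
  stripPrefix (a ∷ u) (b ∷ w) with a ℕ.≟ b
  ... | yes _ = stripPrefix u w
  ... | no _  = nothing

  findInfix : Word → Word → Maybe (Word × Word)
  findInfix u w with stripPrefix u w
  findInfix u w       | just v  = just ([] , v)
  findInfix u []      | nothing = nothing
  findInfix u (b ∷ w) | nothing with findInfix u w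
  ... | just (s , t) = just (b ∷ s , t)
  ... | nothing      = nothing

  -- Drops a trailing zero exponent, keeping exponent lists canonical.
  _∷⁰_ : ℕ → Exponents → Exponents
  zero ∷⁰ [] = []
  e    ∷⁰ p  = e ∷ p

  lowerExponent : ℕ → Exponents → Maybe Exponents
  lowerExponent zero    (suc e ∷ p) = just (e ∷⁰ p)
  lowerExponent (suc i) (e ∷ p) with lowerExponent i p
  ... | just q  = just (e ∷⁰ q)
  ... | nothing = nothing
  lowerExponent _ _ = nothing

  half : ℤ → ℤ
  half (+ n)    = + (n ℕ./ 2)
  half -[1+ n ] = ℤ.- (+ (suc n ℕ./ 2))

module Normalisation {c ℓ} (R : Ring c ℓ) (weight : ℕ → ℕ) (ζ : ℕ → Ring.Carrier R)
    (ζ-central : ∀ i → Centre.Central R (ζ i)) (γ : ℕ → Ring.Carrier R) where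
  open Ring R
  open import Algebra.Properties.Ring R using (-0#≈0#; -‿distribˡ-*; -‿+-comm; x∙y⁻¹≈ε⇒x≈y)
  open import Algebra.Properties.Semiring.Exp semiring using (_^_; ^-homo-*)
  open import Algebra.Properties.CommutativeSemigroup +-commutativeSemigroup
    using (interchange)
  open import Relation.Binary.Reasoning.Setoid setoid
  open IntegerMultiples R
  open Centre R
  open Polynomials weight public

  ⟦_⟧ : Expr → Carrier
  ⟦ cvar i ⟧ = ζ i
  ⟦ gen a ⟧  = γ a
  ⟦ one ⟧    = 1#
  ⟦ zer ⟧    = 0#
  ⟦ a :+ b ⟧ = ⟦ a ⟧ + ⟦ b ⟧
  ⟦ a :* b ⟧ = ⟦ a ⟧ * ⟦ b ⟧
  ⟦ :- a ⟧   = - ⟦ a ⟧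

  ⟦_⟧ʷ : Word → Carrier
  ⟦ [] ⟧ʷ    = 1#
  ⟦ a ∷ w ⟧ʷ = γ a * ⟦ w ⟧ʷ

  ⟦_⟧ᵉ_ : Exponents → ℕ → Carrier
  ⟦ [] ⟧ᵉ i    = 1#
  ⟦ e ∷ p ⟧ᵉ i = ζ i ^ e * ⟦ p ⟧ᵉ suc i

  ⟦_⟧ᵐ : Monomial → Carrier
  ⟦ k , w , p ⟧ᵐ = fromℤ k * (⟦ p ⟧ᵉ 0 * ⟦ w ⟧ʷ)

  ⟦_⟧ᵖ : Polynomial → Carrier
  ⟦ [] ⟧ᵖ    = 0#
  ⟦ m ∷ p ⟧ᵖ = ⟦ m ⟧ᵐ + ⟦ p ⟧ᵖ

  exponents-central : ∀ p i → Central (⟦ p ⟧ᵉ i)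
  exponents-central []      i = central-1#
  exponents-central (e ∷ p) i =
    central-* (central-^ (ζ-central i) e) (exponents-central p (suc i))

  ⊞-sound : ∀ p q i → ⟦ p ⊞ q ⟧ᵉ i ≈ ⟦ p ⟧ᵉ i * ⟦ q ⟧ᵉ i
  ⊞-sound []      q       i = sym (*-identityˡ _)
  ⊞-sound (a ∷ p) []      i = sym (*-identityʳ _)
  ⊞-sound (a ∷ p) (b ∷ q) i = begin
    ζ i ^ (a ℕ.+ b) * ⟦ p ⊞ q ⟧ᵉ suc i
      ≈⟨ *-cong (^-homo-* (ζ i) a b) (⊞-sound p q (suc i)) ⟩
    (ζ i ^ a * ζ i ^ b) * (⟦ p ⟧ᵉ suc i * ⟦ q ⟧ᵉ suc i)
      ≈⟨ middle-swap (central-^ (ζ-central i) b _) _ _ ⟩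
    (ζ i ^ a * ⟦ p ⟧ᵉ suc i) * (ζ i ^ b * ⟦ q ⟧ᵉ suc i) ∎

  ++-sound : ∀ u v → ⟦ u ++ v ⟧ʷ ≈ ⟦ u ⟧ʷ * ⟦ v ⟧ʷ
  ++-sound []      v = sym (*-identityˡ _)
  ++-sound (a ∷ u) v = trans (*-congˡ (++-sound u v)) (sym (*-assoc _ _ _))

  *ₘ-sound : ∀ m n → ⟦ m *ₘ n ⟧ᵐ ≈ ⟦ m ⟧ᵐ * ⟦ n ⟧ᵐ
  *ₘ-sound (k , u , p) (l , v , q) = begin
    fromℤ (k ℤ.* l) * (⟦ p ⊞ q ⟧ᵉ 0 * ⟦ u ++ v ⟧ʷ)
      ≈⟨ *-cong (fromℤ-homo-* k l) (*-cong (⊞-sound p q 0) (++-sound u v)) ⟩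
    (K * L) * ((P * Q) * (U * V))  ≈⟨ *-congˡ (middle-swap (exponents-central q 0 U) P V) ⟩
    (K * L) * ((P * U) * (Q * V))  ≈⟨ middle-swap (fromℤ-central l (P * U)) K (Q * V) ⟩
    (K * (P * U)) * (L * (Q * V))  ∎
    where
    K = fromℤ k; L = fromℤ l; P = ⟦ p ⟧ᵉ 0; Q = ⟦ q ⟧ᵉ 0; U = ⟦ u ⟧ʷ; V = ⟦ v ⟧ʷ

  coefficients-+ : ∀ k l x → fromℤ k * x + fromℤ l * x ≈ fromℤ (k ℤ.+ l) * x
  coefficients-+ k l x = trans (sym (distribʳ x _ _)) (*-congʳ (sym (fromℤ-homo-+ k l)))

  ⊕ₚ-sound       : ∀ p q → ⟦ p ⊕ₚ q ⟧ᵖ ≈ ⟦ p ⟧ᵖ + ⟦ q ⟧ᵖ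
  insert-sound   : ∀ m p q → ⟦ insert m p q ⟧ᵖ ≈ (⟦ m ⟧ᵐ + ⟦ p ⟧ᵖ) + ⟦ q ⟧ᵖ
  insertBy-sound : ∀ m p n q cmp →
                   ⟦ insertBy m p n q cmp ⟧ᵖ ≈ (⟦ m ⟧ᵐ + ⟦ p ⟧ᵖ) + (⟦ n ⟧ᵐ + ⟦ q ⟧ᵖ)
  ⊕ₚ-sound []      q = sym (+-identityˡ _)
  ⊕ₚ-sound (m ∷ p) q = insert-sound m p q
  insert-sound m p []      = sym (+-identityʳ _)
  insert-sound m p (n ∷ q) = insertBy-sound m p n q (compareKey (key m) (key n))
  insertBy-sound m p n q before = begin
    ⟦ m ⟧ᵐ + ⟦ insert n q p ⟧ᵖ            ≈⟨ +-congˡ (insert-sound n q p) ⟩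
    ⟦ m ⟧ᵐ + ((⟦ n ⟧ᵐ + ⟦ q ⟧ᵖ) + ⟦ p ⟧ᵖ) ≈⟨ +-congˡ (+-comm _ _) ⟩
    ⟦ m ⟧ᵐ + (⟦ p ⟧ᵖ + (⟦ n ⟧ᵐ + ⟦ q ⟧ᵖ)) ≈⟨ +-assoc _ _ _ ⟨
    (⟦ m ⟧ᵐ + ⟦ p ⟧ᵖ) + (⟦ n ⟧ᵐ + ⟦ q ⟧ᵖ) ∎
  insertBy-sound m p n q after = begin
    ⟦ n ⟧ᵐ + ⟦ insert m p q ⟧ᵖ            ≈⟨ +-congˡ (insert-sound m p q) ⟩
    ⟦ n ⟧ᵐ + ((⟦ m ⟧ᵐ + ⟦ p ⟧ᵖ) + ⟦ q ⟧ᵖ) ≈⟨ +-assoc _ _ _ ⟨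
    (⟦ n ⟧ᵐ + (⟦ m ⟧ᵐ + ⟦ p ⟧ᵖ)) + ⟦ q ⟧ᵖ ≈⟨ +-congʳ (+-comm _ _) ⟩
    ((⟦ m ⟧ᵐ + ⟦ p ⟧ᵖ) + ⟦ n ⟧ᵐ) + ⟦ q ⟧ᵖ ≈⟨ +-assoc _ _ _ ⟩
    (⟦ m ⟧ᵐ + ⟦ p ⟧ᵖ) + (⟦ n ⟧ᵐ + ⟦ q ⟧ᵖ) ∎
  insertBy-sound (k , K) p (l , .K) q (same ≡.refl) with k ℤ.+ l ℤ.≟ + 0
  ... | yes k+l≡0 = begin
    ⟦ p ⊕ₚ q ⟧ᵖ                               ≈⟨ ⊕ₚ-sound p q ⟩
    ⟦ p ⟧ᵖ + ⟦ q ⟧ᵖ                           ≈⟨ +-identityˡ _ ⟨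
    0# + (⟦ p ⟧ᵖ + ⟦ q ⟧ᵖ)                    ≈⟨ +-congʳ cancel ⟨
    (⟦ k , K ⟧ᵐ + ⟦ l , K ⟧ᵐ) + (⟦ p ⟧ᵖ + ⟦ q ⟧ᵖ) ≈⟨ interchange _ _ _ _ ⟩
    (⟦ k , K ⟧ᵐ + ⟦ p ⟧ᵖ) + (⟦ l , K ⟧ᵐ + ⟦ q ⟧ᵖ) ∎
    where
    cancel : ⟦ k , K ⟧ᵐ + ⟦ l , K ⟧ᵐ ≈ 0#
    cancel = trans (coefficients-+ k l _)
                   (trans (*-congʳ (reflexive (≡.cong fromℤ k+l≡0))) (zeroˡ _))
  ... | no _ = begin
    ⟦ k ℤ.+ l , K ⟧ᵐ + ⟦ p ⊕ₚ q ⟧ᵖ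
      ≈⟨ +-cong (sym (coefficients-+ k l _)) (⊕ₚ-sound p q) ⟩
    (⟦ k , K ⟧ᵐ + ⟦ l , K ⟧ᵐ) + (⟦ p ⟧ᵖ + ⟦ q ⟧ᵖ) ≈⟨ interchange _ _ _ _ ⟩
    (⟦ k , K ⟧ᵐ + ⟦ p ⟧ᵖ) + (⟦ l , K ⟧ᵐ + ⟦ q ⟧ᵖ) ∎

  scale-sound : ∀ m q → ⟦ scale m q ⟧ᵖ ≈ ⟦ m ⟧ᵐ * ⟦ q ⟧ᵖ
  scale-sound m []      = sym (zeroʳ _)
  scale-sound m (n ∷ q) =
    trans (+-cong (*ₘ-sound m n) (scale-sound m q)) (sym (distribˡ _ _ _))

  ⊗ₚ-sound : ∀ p q → ⟦ p ⊗ₚ q ⟧ᵖ ≈ ⟦ p ⟧ᵖ * ⟦ q ⟧ᵖ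
  ⊗ₚ-sound []      q = sym (zeroˡ _)
  ⊗ₚ-sound (m ∷ p) q = begin
    ⟦ scale m q ⊕ₚ p ⊗ₚ q ⟧ᵖ      ≈⟨ ⊕ₚ-sound (scale m q) (p ⊗ₚ q) ⟩
    ⟦ scale m q ⟧ᵖ + ⟦ p ⊗ₚ q ⟧ᵖ  ≈⟨ +-cong (scale-sound m q) (⊗ₚ-sound p q) ⟩
    ⟦ m ⟧ᵐ * ⟦ q ⟧ᵖ + ⟦ p ⟧ᵖ * ⟦ q ⟧ᵖ ≈⟨ distribʳ _ _ _ ⟨
    (⟦ m ⟧ᵐ + ⟦ p ⟧ᵖ) * ⟦ q ⟧ᵖ     ∎

  ⊝ₚ-sound : ∀ p → ⟦ ⊝ₚ p ⟧ᵖ ≈ - ⟦ p ⟧ᵖ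
  ⊝ₚ-sound []              = sym -0#≈0#
  ⊝ₚ-sound ((k , K) ∷ p) = begin
    fromℤ (ℤ.- k) * X + ⟦ ⊝ₚ p ⟧ᵖ ≈⟨ +-cong (*-congʳ (fromℤ-homo-‿ k)) (⊝ₚ-sound p) ⟩
    - fromℤ k * X + - ⟦ p ⟧ᵖ      ≈⟨ +-congʳ (-‿distribˡ-* _ _) ⟨
    - (fromℤ k * X) + - ⟦ p ⟧ᵖ    ≈⟨ -‿+-comm _ _ ⟩
    - (fromℤ k * X + ⟦ p ⟧ᵖ)      ∎
    where X = ⟦ proj₂ K ⟧ᵉ 0 * ⟦ proj₁ K ⟧ʷ

  monic : ∀ x → fromℤ (+ 1) * x + 0# ≈ x
  monic x = trans (+-identityʳ _) (trans (*-congʳ (+-identityʳ 1#)) (*-identityˡ x))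

  unitExponents-sound : ∀ i j → ⟦ unitExponents i ⟧ᵉ j ≈ ζ (j ℕ.+ i)
  unitExponents-sound zero    j = trans (*-identityʳ _) (trans (*-identityʳ _)
                                    (reflexive (≡.cong ζ (≡.sym (ℕ.+-identityʳ j)))))
  unitExponents-sound (suc i) j = trans (*-identityˡ _) (trans (unitExponents-sound i (suc j))
                                    (reflexive (≡.cong ζ (≡.sym (ℕ.+-suc j i)))))

  normalise-sound : ∀ e → ⟦ normalise e ⟧ᵖ ≈ ⟦ e ⟧
  normalise-sound (cvar i) = trans (monic _) (trans (*-identityʳ _) (unitExponents-sound i 0))
  normalise-sound (gen a)  = trans (monic _) (trans (*-identityˡ _) (*-identityʳ _))
  normalise-sound one      = trans (monic _) (*-identityˡ _)
  normalise-sound zer      = refl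
  normalise-sound (a :+ b) =
    trans (⊕ₚ-sound (normalise a) _) (+-cong (normalise-sound a) (normalise-sound b))
  normalise-sound (a :* b) =
    trans (⊗ₚ-sound (normalise a) _) (*-cong (normalise-sound a) (normalise-sound b))
  normalise-sound (:- a)   = trans (⊝ₚ-sound (normalise a)) (-‿cong (normalise-sound a))

  wordExpr : Word → Expr
  wordExpr []          = one
  wordExpr (a ∷ [])    = gen a
  wordExpr (a ∷ b ∷ w) = gen a :* wordExpr (b ∷ w)

  wordExpr-sound : ∀ w → ⟦ wordExpr w ⟧ ≈ ⟦ w ⟧ʷ
  wordExpr-sound []          = refl
  wordExpr-sound (a ∷ [])    = sym (*-identityʳ _)
  wordExpr-sound (a ∷ b ∷ w) = *-congˡ (wordExpr-sound (b ∷ w))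

  record Rule : Set (c ⊔ ℓ) where
    field
      lhs   : Word
      rhs   : Polynomial
      sound : ⟦ lhs ⟧ʷ ≈ ⟦ rhs ⟧ᵖ

  rule : ∀ w e → ⟦ wordExpr w ⟧ ≈ ⟦ e ⟧ → Rule
  rule w e w≈e = record
    { lhs = w ; rhs = normalise e
    ; sound = trans (sym (wordExpr-sound w)) (trans w≈e (sym (normalise-sound e))) }

  record HalvingRule : Set (c ⊔ ℓ) where
    field
      index  : ℕ
      halves : (1# + 1#) * ζ index ≈ 1#

  stripPrefix-sound : ∀ u w → All (λ v → w ≡ u ++ v) (stripPrefix u w)
  stripPrefix-sound []      w       = just ≡.refl
  stripPrefix-sound (_ ∷ _) []      = nothing
  stripPrefix-sound (a ∷ u) (b ∷ w) with a ℕ.≟ b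
  ... | no _       = nothing
  ... | yes ≡.refl with stripPrefix u w | stripPrefix-sound u w
  ...   | just _  | just w≡uv = just (≡.cong (a ∷_) w≡uv)
  ...   | nothing | nothing   = nothing

  InfixOf : Word → Word → Word × Word → Set
  InfixOf u w (s , t) = w ≡ s ++ (u ++ t)

  findInfix-sound : ∀ u w → All (InfixOf u w) (findInfix u w)
  findInfix-sound u w with stripPrefix u w | stripPrefix-sound u w
  findInfix-sound u w       | just _  | just w≡uv = just w≡uv
  findInfix-sound u []      | nothing | nothing   = nothing
  findInfix-sound u (b ∷ w) | nothing | nothing with findInfix u w | findInfix-sound u w
  ... | just _  | just w≡sut = just (≡.cong (b ∷_) w≡sut)
  ... | nothing | nothing    = nothing

  ·ʷ-sound : ∀ q v → ⟦ q ·ʷ v ⟧ᵖ ≈ ⟦ q ⟧ᵖ * ⟦ v ⟧ʷ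
  ·ʷ-sound []                v = sym (zeroˡ _)
  ·ʷ-sound ((k , u , p) ∷ q) v = begin
    fromℤ k * (P * ⟦ u ++ v ⟧ʷ) + ⟦ q ·ʷ v ⟧ᵖ
      ≈⟨ +-cong (*-congˡ (*-congˡ (++-sound u v))) (·ʷ-sound q v) ⟩
    fromℤ k * (P * (⟦ u ⟧ʷ * V)) + ⟦ q ⟧ᵖ * V
      ≈⟨ +-congʳ (trans (*-congˡ (sym (*-assoc _ _ _))) (sym (*-assoc _ _ _))) ⟩
    fromℤ k * (P * ⟦ u ⟧ʷ) * V + ⟦ q ⟧ᵖ * V ≈⟨ distribʳ _ _ _ ⟨
    (fromℤ k * (P * ⟦ u ⟧ʷ) + ⟦ q ⟧ᵖ) * V  ∎
    where P = ⟦ p ⟧ᵉ 0; V = ⟦ v ⟧ʷ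

  rewriteAt : Rule → ℤ → Word → Word → Exponents → Polynomial
  rewriteAt r k s t p = scale (k , s , p) (Rule.rhs r ·ʷ t)

  rewriteAt-sound : ∀ r k s t p →
                    ⟦ rewriteAt r k s t p ⟧ᵖ ≈ ⟦ k , s ++ (Rule.lhs r ++ t) , p ⟧ᵐ
  rewriteAt-sound r k s t p = begin
    ⟦ scale (k , s , p) (Rule.rhs r ·ʷ t) ⟧ᵖ  ≈⟨ scale-sound (k , s , p) (Rule.rhs r ·ʷ t) ⟩
    ⟦ k , s , p ⟧ᵐ * ⟦ Rule.rhs r ·ʷ t ⟧ᵖ     ≈⟨ *-congˡ (·ʷ-sound (Rule.rhs r) t) ⟩
    ⟦ k , s , p ⟧ᵐ * (⟦ Rule.rhs r ⟧ᵖ * T)   ≈⟨ *-congˡ (*-congʳ (Rule.sound r)) ⟨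
    ⟦ k , s , p ⟧ᵐ * (⟦ Rule.lhs r ⟧ʷ * T)   ≈⟨ *-congˡ (++-sound (Rule.lhs r) t) ⟨
    (K * (P * ⟦ s ⟧ʷ)) * ⟦ Rule.lhs r ++ t ⟧ʷ ≈⟨ trans (*-assoc _ _ _) (*-congˡ (*-assoc _ _ _)) ⟩
    K * (P * (⟦ s ⟧ʷ * ⟦ Rule.lhs r ++ t ⟧ʷ)) ≈⟨ *-congˡ (*-congˡ (++-sound s _)) ⟨
    K * (P * ⟦ s ++ (Rule.lhs r ++ t) ⟧ʷ)    ∎
    where K = fromℤ k; P = ⟦ p ⟧ᵉ 0; T = ⟦ t ⟧ʷ

  applyRules : List Rule → Monomial → Maybe Polynomial
  applyRules []       m           = nothing
  applyRules (r ∷ rs) (k , w , p) with findInfix (Rule.lhs r) w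
  ... | just (s , t) = just (rewriteAt r k s t p)
  ... | nothing      = applyRules rs (k , w , p)

  applyRules-sound : ∀ rs m → All (λ q → ⟦ q ⟧ᵖ ≈ ⟦ m ⟧ᵐ) (applyRules rs m)
  applyRules-sound []       m           = nothing
  applyRules-sound (r ∷ rs) (k , w , p)
    with findInfix (Rule.lhs r) w | findInfix-sound (Rule.lhs r) w
  ... | just (s , t) | just w≡slt = just (trans (rewriteAt-sound r k s t p)
                                         (reflexive (≡.cong (λ v → ⟦ k , v , p ⟧ᵐ) (≡.sym w≡slt))))
  ... | nothing      | nothing    = applyRules-sound rs (k , w , p)

  ∷⁰-sound : ∀ e p j → ⟦ e ∷⁰ p ⟧ᵉ j ≈ ⟦ e ∷ p ⟧ᵉ j
  ∷⁰-sound zero    []      j = sym (*-identityˡ _)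
  ∷⁰-sound zero    (_ ∷ _) j = refl
  ∷⁰-sound (suc e) p       j = refl

  lowerExponent-sound : ∀ i p j →
    All (λ q → ⟦ p ⟧ᵉ j ≈ ζ (j ℕ.+ i) * ⟦ q ⟧ᵉ j) (lowerExponent i p)
  lowerExponent-sound zero    []          j = nothing
  lowerExponent-sound zero    (zero ∷ p)  j = nothing
  lowerExponent-sound zero    (suc e ∷ p) j = just (begin
    (ζ j * ζ j ^ e) * ⟦ p ⟧ᵉ suc j  ≈⟨ *-assoc _ _ _ ⟩
    ζ j * (ζ j ^ e * ⟦ p ⟧ᵉ suc j)  ≈⟨ *-cong (reflexive (≡.cong ζ (≡.sym (ℕ.+-identityʳ j))))
                                              (sym (∷⁰-sound e p j)) ⟩
    ζ (j ℕ.+ 0) * ⟦ e ∷⁰ p ⟧ᵉ j     ∎)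
  lowerExponent-sound (suc i) []      j = nothing
  lowerExponent-sound (suc i) (e ∷ p) j
    with lowerExponent i p | lowerExponent-sound i p (suc j)
  ... | nothing | nothing = nothing
  ... | just q  | just p≈ζq = just (begin
    ζ j ^ e * ⟦ p ⟧ᵉ suc j                   ≈⟨ *-congˡ p≈ζq ⟩
    ζ j ^ e * (ζ (suc j ℕ.+ i) * ⟦ q ⟧ᵉ suc j) ≈⟨ central-swap (ζ-central _) _ _ ⟩
    ζ (suc j ℕ.+ i) * (ζ j ^ e * ⟦ q ⟧ᵉ suc j) ≈⟨ *-cong (reflexive (≡.cong ζ (≡.sym (ℕ.+-suc j i))))
                                                       (sym (∷⁰-sound e q j)) ⟩
    ζ (j ℕ.+ suc i) * ⟦ e ∷⁰ q ⟧ᵉ j            ∎)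

  -- (2k) · ζᵢ · m becomes k · m when 2 ζᵢ = 1.
  halve : Maybe HalvingRule → Monomial → Maybe Monomial
  halve nothing  m           = nothing
  halve (just h) (k , w , p) with lowerExponent (HalvingRule.index h) p
  ... | nothing = nothing
  ... | just q with k ℤ.≟ half k ℤ.+ half k
  ...   | yes _ = just (half k , w , q)
  ...   | no _  = nothing

  halve-sound : ∀ h m → All (λ n → ⟦ n ⟧ᵐ ≈ ⟦ m ⟧ᵐ) (halve h m)
  halve-sound nothing  m           = nothing
  halve-sound (just h) (k , w , p)
    with lowerExponent (HalvingRule.index h) p | lowerExponent-sound (HalvingRule.index h) p 0
  ... | nothing | nothing = nothing
  ... | just q  | just p≈ζq with k ℤ.≟ half k ℤ.+ half k
  ...   | no _        = nothing
  ...   | yes k≡2half = just (sym (begin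
    fromℤ k * (⟦ p ⟧ᵉ 0 * W)                  ≈⟨ *-cong (reflexive (≡.cong fromℤ k≡2half))
                                                          (*-congʳ p≈ζq) ⟩
    fromℤ (k/2 ℤ.+ k/2) * ((H * Q) * W)        ≈⟨ *-cong (fromℤ-homo-+ k/2 k/2) (*-assoc _ _ _) ⟩
    (K + K) * (H * (Q * W))                   ≈⟨ *-congʳ (+-cong (*-identityʳ K) (*-identityʳ K)) ⟨
    (K * 1# + K * 1#) * (H * (Q * W))         ≈⟨ *-congʳ (distribˡ K 1# 1#) ⟨
    (K * (1# + 1#)) * (H * (Q * W))           ≈⟨ trans (*-assoc _ _ _) (*-congˡ (sym (*-assoc _ _ _))) ⟩
    K * (((1# + 1#) * H) * (Q * W))           ≈⟨ *-congˡ (*-congʳ (HalvingRule.halves h)) ⟩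
    K * (1# * (Q * W))                        ≈⟨ *-congˡ (*-identityˡ _) ⟩
    K * (Q * W)                               ∎))
    where
    k/2 = half k; K = fromℤ k/2; W = ⟦ w ⟧ʷ; Q = ⟦ q ⟧ᵉ 0; H = ζ (HalvingRule.index h)

  reduce : List Rule → Maybe HalvingRule → ℕ → Polynomial → Polynomial
  reduce rs h zero    p       = p
  reduce rs h (suc n) []      = []
  reduce rs h (suc n) (m ∷ p) with applyRules rs m
  ... | just q  = reduce rs h n (q ⊕ₚ p)
  ... | nothing with halve h m
  ...   | just m′ = reduce rs h n (insert m′ [] p)
  ...   | nothing = m ∷ reduce rs h n p

  reduce-sound : ∀ rs h n p → ⟦ reduce rs h n p ⟧ᵖ ≈ ⟦ p ⟧ᵖ
  reduce-sound rs h zero    p       = refl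
  reduce-sound rs h (suc n) []      = refl
  reduce-sound rs h (suc n) (m ∷ p) with applyRules rs m | applyRules-sound rs m
  ... | just q  | just q≈m = trans (reduce-sound rs h n (q ⊕ₚ p))
                                   (trans (⊕ₚ-sound q p) (+-congʳ q≈m))
  ... | nothing | nothing with halve h m | halve-sound h m
  ...   | just m′ | just m′≈m = trans (reduce-sound rs h n (insert m′ [] p))
                                      (trans (insert-sound m′ [] p) (+-congʳ (trans (+-identityʳ _) m′≈m)))
  ...   | nothing | nothing   = +-congˡ (reduce-sound rs h n p)

  fuel : ℕ
  fuel = 100000

  Reduces : List Rule → Maybe HalvingRule → Expr → Expr → Set
  Reduces rs h l r = reduce rs h fuel (normalise (l :− r)) ≡ []

  prove : ∀ rs h l r → Reduces rs h l r → ⟦ l ⟧ ≈ ⟦ r ⟧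
  prove rs h l r l-r↝0 = x∙y⁻¹≈ε⇒x≈y _ _ (begin
    ⟦ l :− r ⟧                                ≈⟨ normalise-sound (l :− r) ⟨
    ⟦ normalise (l :− r) ⟧ᵖ                   ≈⟨ reduce-sound rs h fuel (normalise (l :− r)) ⟨
    ⟦ reduce rs h fuel (normalise (l :− r)) ⟧ᵖ ≡⟨ ≡.cong ⟦_⟧ᵖ l-r↝0 ⟩
    0#                                        ∎)

  prove-modulo : ∀ rs h l r z → ⟦ z ⟧ ≈ 0# → Reduces rs h (l :− r) z → ⟦ l ⟧ ≈ ⟦ r ⟧
  prove-modulo rs h l r z z≈0 l-r-z↝0 =
    x∙y⁻¹≈ε⇒x≈y _ _ (trans (prove rs h (l :− r) z l-r-z↝0) z≈0)

  ruleFromRelation : ∀ w e z → ⟦ z ⟧ ≈ 0# → Reduces [] nothing (wordExpr w :− e) z → Rule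
  ruleFromRelation w e z z≈0 w-e↝z = rule w e (prove-modulo [] nothing (wordExpr w) e z z≈0 w-e↝z)

-- Matrix operations on expressions, defined entrywise exactly as those of Defs, so that
-- evaluating A M*ᴱ B entrywise is definitionally the product of the evaluations.
MatExpr : Set
MatExpr = Fin 3 → Fin 3 → Expr

infixl 6 _M+ᴱ_
infixl 7 _M*ᴱ_

_M+ᴱ_ : MatExpr → MatExpr → MatExpr
(A M+ᴱ B) i j = A i j :+ B i j

M-ᴱ_ : MatExpr → MatExpr
(M-ᴱ A) i j = :- A i j

_M*ᴱ_ : MatExpr → MatExpr → MatExpr
(A M*ᴱ B) i j = A i zero :* B zero j :+ A i (suc zero) :* B (suc zero) j
                  :+ A i (suc (suc zero)) :* B (suc (suc zero)) j

matᴱ : Expr → Expr → Expr → Expr → Expr → Expr → Expr → Expr → Expr → MatExpr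
matᴱ e₀₀ e₀₁ e₀₂ e₁₀ e₁₁ e₁₂ e₂₀ e₂₁ e₂₂ = λ where
  zero zero → e₀₀
  zero (suc zero) → e₀₁
  zero (suc (suc zero)) → e₀₂
  (suc zero) zero → e₁₀
  (suc zero) (suc zero) → e₁₁
  (suc zero) (suc (suc zero)) → e₁₂
  (suc (suc zero)) zero → e₂₀
  (suc (suc zero)) (suc zero) → e₂₁
  (suc (suc zero)) (suc (suc zero)) → e₂₂

scalarᴱ : Expr → MatExpr
scalarᴱ e = matᴱ e zer zer zer e zer zer zer e

unitᴱ : Fin 3 → Fin 3 → MatExpr
unitᴱ i j k l with k ≟ i | l ≟ j
... | yes _ | yes _ = one
... | _     | _     = zer

sum₃ : ∀ {a} {A : Set a} → (A → A → A) → (Fin 3 → A) → A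
sum₃ _∙_ f = (f zero ∙ f (suc zero)) ∙ f (suc (suc zero))

sum₃ₓ₃ : ∀ {a} {A : Set a} → (A → A → A) → (Fin 3 → Fin 3 → A) → A
sum₃ₓ₃ _∙_ f = sum₃ _∙_ (λ i → sum₃ _∙_ (f i))

module _ {a r} {A : Set a} {_≈_ : A → A → Set r} (_∙_ : A → A → A)
         (∙-cong : ∀ {x x′ y y′} → x ≈ x′ → y ≈ y′ → (x ∙ y) ≈ (x′ ∙ y′)) where

  sum₃-cong : ∀ {f g} → (∀ i → f i ≈ g i) → sum₃ _∙_ f ≈ sum₃ _∙_ g
  sum₃-cong f≈g = ∙-cong (∙-cong (f≈g zero) (f≈g (suc zero))) (f≈g (suc (suc zero)))

  sum₃ₓ₃-cong : ∀ {f g} → (∀ i j → f i j ≈ g i j) → sum₃ₓ₃ _∙_ f ≈ sum₃ₓ₃ _∙_ g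
  sum₃ₓ₃-cong f≈g = sum₃-cong (λ i → sum₃-cong (f≈g i))

entryIndex : Fin 3 → Fin 3 → ℕ
entryIndex i j = 3 ℕ.* toℕ i ℕ.+ toℕ j

variableMatrix : (ℕ → Expr) → ℕ → MatExpr
variableMatrix var o i j = var (o ℕ.+ entryIndex i j)

module Presentation {c ℓ} (K : Field c ℓ) where
  open Field K using (1#) renaming (_≈_ to _≈ᴷ_; _+_ to _+ᴷ_; _*_ to _*ᴷ_; 0# to 0ᴷ)
  open WithField K

  entries : Mat → List T
  entries A = A zero zero ∷ A zero (suc zero) ∷ A zero (suc (suc zero))
            ∷ A (suc zero) zero ∷ A (suc zero) (suc zero) ∷ A (suc zero) (suc (suc zero))
            ∷ A (suc (suc zero)) zero ∷ A (suc (suc zero)) (suc zero)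
            ∷ A (suc (suc zero)) (suc (suc zero)) ∷ []

  unitMat : Fin 3 → Fin 3 → Mat
  unitMat i j k l with k ≟ i | l ≟ j
  ... | yes _ | yes _ = con 1#
  ... | _     | _     = con 0ᴷ

  nth : List T → ℕ → T
  nth []       n       = con 0ᴷ
  nth (t ∷ ts) zero    = t
  nth (t ∷ ts) (suc n) = nth ts n

  nth-entries : ∀ A i j → nth (entries A) (entryIndex i j) ≡ A i j
  nth-entries A zero             zero             = ≡.refl
  nth-entries A zero             (suc zero)       = ≡.refl
  nth-entries A zero             (suc (suc zero)) = ≡.refl
  nth-entries A (suc zero)       zero             = ≡.refl
  nth-entries A (suc zero)       (suc zero)       = ≡.refl
  nth-entries A (suc zero)       (suc (suc zero)) = ≡.refl
  nth-entries A (suc (suc zero)) zero             = ≡.refl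
  nth-entries A (suc (suc zero)) (suc zero)       = ≡.refl
  nth-entries A (suc (suc zero)) (suc (suc zero)) = ≡.refl

  module PresentedAlgebra (R : T → Set c) where

    ring : Ring c (c ⊔ ℓ)
    ring = record
      { Carrier = T ; _≈_ = _∼⟨ R ⟩_ ; _+_ = _⊕_ ; _*_ = _⊗_ ; -_ = ⊝_ ; 0# = con 0ᴷ ; 1# = con 1#
      ; isRing = record
        { +-isAbelianGroup = record
          { isGroup = record
            { isMonoid = record
              { isSemigroup = record
                { isMagma = record
                  { isEquivalence = record { refl = ∼-refl ; sym = ∼-sym ; trans = ∼-trans }
                  ; ∙-cong = ⊕-cong }
                ; assoc = λ _ _ _ → ⊕-assoc }
              ; identity = (λ _ → ∼-trans ⊕-comm ⊕-idʳ) , (λ _ → ⊕-idʳ) }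
            ; inverse = (λ _ → ∼-trans ⊕-comm ⊕-invʳ) , (λ _ → ⊕-invʳ)
            ; ⁻¹-cong = ⊝-cong }
          ; comm = λ _ _ → ⊕-comm }
        ; *-cong = ⊗-cong
        ; *-assoc = λ _ _ _ → ⊗-assoc
        ; *-identity = (λ _ → ⊗-idˡ) , (λ _ → ⊗-idʳ)
        ; distrib = (λ _ _ _ → distribˡ) , (λ _ _ _ → distribʳ) } }

    open Ring ring public using () renaming (reflexive to ∼-reflexive)
    open Centre ring public

    central-con : ∀ a → Central (con a)
    central-con a t = con-central

    central-by-generators : ∀ {z} → Commute z gx → Commute z gy → Central z
    central-by-generators zx zy gx      = zx
    central-by-generators zx zy gy      = zy
    central-by-generators zx zy (con a) = ∼-sym con-central
    central-by-generators zx zy (s ⊕ t) =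
      commute-+ (central-by-generators zx zy s) (central-by-generators zx zy t)
    central-by-generators zx zy (s ⊗ t) =
      commute-* (central-by-generators zx zy s) (central-by-generators zx zy t)
    central-by-generators zx zy (⊝ s)   = commute-‿ (central-by-generators zx zy s)

    con-halves : ∀ {h} → (1# +ᴷ 1#) *ᴷ h ≈ᴷ 1# → (con 1# ⊕ con 1#) ⊗ con h ∼⟨ R ⟩ con 1#
    con-halves 2h≈1 = ∼-trans (⊗-cong (∼-sym con-+) ∼-refl) (∼-trans (∼-sym con-*) (con-cong 2h≈1))

  module MatrixAlgebra (R : T → Set c) where
    open PresentedAlgebra R

    infix 4 _≈ᴹ_
    _≈ᴹ_ : Mat → Mat → Set (c ⊔ ℓ)
    A ≈ᴹ B = A ≈M⟨ R ⟩ B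

    matrixSetoid : Setoid c (c ⊔ ℓ)
    matrixSetoid = record
      { Carrier = Mat ; _≈_ = _≈ᴹ_
      ; isEquivalence = record
        { refl  = λ i j → ∼-refl
        ; sym   = λ A≈B i j → ∼-sym (A≈B i j)
        ; trans = λ A≈B B≈C i j → ∼-trans (A≈B i j) (B≈C i j) } }

    open Setoid matrixSetoid public using ()
      renaming (refl to ≈ᴹ-refl; sym to ≈ᴹ-sym; trans to ≈ᴹ-trans)

    -- With ≡.refl, relates two matrices that agree at each concrete index.
    ≈ᴹ-entrywise : ∀ {A B} → entries A ≡ entries B → A ≈ᴹ B
    ≈ᴹ-entrywise {A} {B} eq i j = ∼-reflexive (begin
      A i j                            ≡⟨ nth-entries A i j ⟨
      nth (entries A) (entryIndex i j) ≡⟨ ≡.cong (λ ts → nth ts (entryIndex i j)) eq ⟩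
      nth (entries B) (entryIndex i j) ≡⟨ nth-entries B i j ⟩
      B i j                            ∎)
      where open ≡.≡-Reasoning

    M+-cong : ∀ {A A′ B B′} → A ≈ᴹ A′ → B ≈ᴹ B′ → A M+ B ≈ᴹ A′ M+ B′
    M+-cong A≈ B≈ i j = ⊕-cong (A≈ i j) (B≈ i j)

    M--cong : ∀ {A A′} → A ≈ᴹ A′ → M- A ≈ᴹ M- A′
    M--cong A≈ i j = ⊝-cong (A≈ i j)

    M*-cong : ∀ {A A′ B B′} → A ≈ᴹ A′ → B ≈ᴹ B′ → A M* B ≈ᴹ A′ M* B′
    M*-cong A≈ B≈ i j = ⊕-cong (⊕-cong (⊗-cong (A≈ i zero) (B≈ zero j))
                                         (⊗-cong (A≈ i (suc zero)) (B≈ (suc zero) j)))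
                                (⊗-cong (A≈ i (suc (suc zero))) (B≈ (suc (suc zero)) j))

    scalarMat-cong : ∀ {s t} → s ∼⟨ R ⟩ t → scalarMat s ≈ᴹ scalarMat t
    scalarMat-cong s∼t i j with i ≟ j
    ... | yes _ = s∼t
    ... | no _  = ∼-refl

    scalarMat-homo-+ : ∀ s t → scalarMat (s ⊕ t) ≈ᴹ scalarMat s M+ scalarMat t
    scalarMat-homo-+ s t i j with i ≟ j
    ... | yes _ = ∼-refl
    ... | no _  = ∼-sym ⊕-idʳ

    scalarMat-zero : scalarMat (con 0ᴷ) ≈ᴹ (λ _ _ → con 0ᴷ)
    scalarMat-zero i j with i ≟ j
    ... | yes _ = ∼-refl
    ... | no _  = ∼-refl

    scalarMat-homo-‿ : ∀ s → scalarMat (⊝ s) ≈ᴹ M- scalarMat s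
    scalarMat-homo-‿ s i j with i ≟ j
    ... | yes _ = ∼-refl
    ... | no _  = ∼-sym -0#≈0#
      where open import Algebra.Properties.Ring ring using (-0#≈0#)

    module Reified (weight : ℕ → ℕ) (ζ : ℕ → T) (ζ-central : ∀ i → Central (ζ i)) (γ : ℕ → T) where
      open Normalisation ring weight ζ ζ-central γ public

      ⟦_⟧ᴹ : MatExpr → Mat
      ⟦ A ⟧ᴹ i j = ⟦ A i j ⟧

      MatricesReduce : List Rule → Maybe HalvingRule → MatExpr → MatExpr → Set
      MatricesReduce rs h A B =
        tabulate (λ i → tabulate (λ j → reduce rs h fuel (normalise (A i j :− B i j)))) ≡
        tabulate (λ _ → tabulate (λ _ → []))

      matrixRules : ∀ (w : Fin 3 → Fin 3 → Word) (e : MatExpr) →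
                    (λ i j → ⟦ wordExpr (w i j) ⟧) ≈ᴹ ⟦ e ⟧ᴹ → List Rule
      matrixRules w e w≈e =
        cartesianProductWith (λ i j → rule (w i j) (e i j) (w≈e i j)) (allFin 3) (allFin 3)

      prove-matrix : ∀ rs h A B → MatricesReduce rs h A B → ⟦ A ⟧ᴹ ≈ᴹ ⟦ B ⟧ᴹ
      prove-matrix rs h A B A-B↝0 i j = prove rs h (A i j) (B i j)
        (tabulate²-injective {f = λ i j → reduce rs h fuel (normalise (A i j :− B i j))} A-B↝0 i j)

      prove-matrix-via : ∀ rs h {X Y} Xᴱ Yᴱ → entries X ≡ entries ⟦ Xᴱ ⟧ᴹ → entries ⟦ Yᴱ ⟧ᴹ ≡ entries Y →
                         MatricesReduce rs h Xᴱ Yᴱ → X ≈ᴹ Y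
      prove-matrix-via rs h Xᴱ Yᴱ X≡ Y≡ X-Y↝0 =
        ≈ᴹ-trans (≈ᴹ-entrywise X≡) (≈ᴹ-trans (prove-matrix rs h Xᴱ Yᴱ X-Y↝0) (≈ᴹ-entrywise Y≡))

    module Laws (A B C : Mat) where
      open Reified (λ _ → 1) (λ _ → con 0ᴷ) (λ _ → central-con 0ᴷ)
                   (nth (entries A ++ entries B ++ entries C))

      Aᴱ Bᴱ Cᴱ : MatExpr
      Aᴱ = variableMatrix gen 0
      Bᴱ = variableMatrix gen 9
      Cᴱ = variableMatrix gen 18

      M*-assoc : (A M* B) M* C ≈ᴹ A M* (B M* C)
      M*-assoc = prove-matrix-via [] nothing ((Aᴱ M*ᴱ Bᴱ) M*ᴱ Cᴱ) (Aᴱ M*ᴱ (Bᴱ M*ᴱ Cᴱ))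
        ≡.refl ≡.refl ≡.refl

      M*-distribˡ : A M* (B M+ C) ≈ᴹ (A M* B) M+ (A M* C)
      M*-distribˡ = prove-matrix-via [] nothing (Aᴱ M*ᴱ (Bᴱ M+ᴱ Cᴱ)) (Aᴱ M*ᴱ Bᴱ M+ᴱ Aᴱ M*ᴱ Cᴱ)
        ≡.refl ≡.refl ≡.refl

      M*-distribʳ : (B M+ C) M* A ≈ᴹ (B M* A) M+ (C M* A)
      M*-distribʳ = prove-matrix-via [] nothing ((Bᴱ M+ᴱ Cᴱ) M*ᴱ Aᴱ) (Bᴱ M*ᴱ Aᴱ M+ᴱ Cᴱ M*ᴱ Aᴱ)
        ≡.refl ≡.refl ≡.refl

    M*-identityˡ : ∀ A → scalarMat (con 1#) M* A ≈ᴹ A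
    M*-identityˡ A = prove-matrix-via [] nothing
      (scalarᴱ one M*ᴱ variableMatrix gen 0) (variableMatrix gen 0) ≡.refl ≡.refl ≡.refl
      where open Reified (λ _ → 1) (λ _ → con 0ᴷ) (λ _ → central-con 0ᴷ) (nth (entries A))

    M*-identityʳ : ∀ A → A M* scalarMat (con 1#) ≈ᴹ A
    M*-identityʳ A = prove-matrix-via [] nothing
      (variableMatrix gen 0 M*ᴱ scalarᴱ one) (variableMatrix gen 0) ≡.refl ≡.refl ≡.refl
      where open Reified (λ _ → 1) (λ _ → con 0ᴷ) (λ _ → central-con 0ᴷ) (nth (entries A))

    scalarMat-con-central : ∀ a A → scalarMat (con a) M* A ≈ᴹ A M* scalarMat (con a)
    scalarMat-con-central a A = prove-matrix-via [] nothing
      (scalarᴱ (cvar 0) M*ᴱ variableMatrix gen 0) (variableMatrix gen 0 M*ᴱ scalarᴱ (cvar 0))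
      ≡.refl ≡.refl ≡.refl
      where open Reified (λ _ → 1) (λ _ → con a) (λ _ → central-con a) (nth (entries A))

    scalarMat-homo-* : ∀ s t → scalarMat (s ⊗ t) ≈ᴹ scalarMat s M* scalarMat t
    scalarMat-homo-* s t =
      prove-matrix-via [] nothing (scalarᴱ (gen 0 :* gen 1)) (scalarᴱ (gen 0) M*ᴱ scalarᴱ (gen 1))
        ≡.refl ≡.refl ≡.refl
      where open Reified (λ _ → 1) (λ _ → con 0ᴷ) (λ _ → central-con 0ᴷ) (nth (s ∷ t ∷ []))

module WeierstrassCurve {c ℓ} (K : Field c ℓ) (a₁ a₂ a₃ a₄ a₆ : Field.Carrier K)
    (char≢2 : ¬ (Field._≈_ K (WithField.Weierstrass.2# K a₁ a₂ a₃ a₄ a₆) (Field.0# K))) where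
  open Field K using (Carrier; _≈_; _*_; 0#; 1#; inverse)
  open WithField K
  open Weierstrass a₁ a₂ a₃ a₄ a₆
  open Presentation K

  ½ : Carrier
  ½ = proj₁ (inverse 2# char≢2)

  ½-halves : 2# * ½ ≈ 1#
  ½-halves = proj₂ (inverse 2# char≢2)

  coefficient : ℕ → Carrier
  coefficient 0 = a₁
  coefficient 1 = a₂
  coefficient 2 = a₃
  coefficient 3 = a₄
  coefficient 4 = a₆
  coefficient 5 = ½
  coefficient _ = 0#

  A₁ A₂ A₃ A₄ A₆ ½ᴱ : Expr
  A₁ = cvar 0
  A₂ = cvar 1
  A₃ = cvar 2
  A₄ = cvar 3
  A₆ = cvar 4
  ½ᴱ = cvar 5

  F : T → T → T
  F x y = y ⊗ y ⊕ con a₁ ⊗ x ⊗ y ⊕ con a₃ ⊗ y ⊖ (x ⊗ x ⊗ x ⊕ con a₂ ⊗ (x ⊗ x) ⊕ con a₄ ⊗ x ⊕ con a₆)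

  Fᴱ : Expr → Expr → Expr
  Fᴱ X Y = Y :* Y :+ A₁ :* X :* Y :+ A₃ :* Y :− (X :* X :* X :+ A₂ :* (X :* X) :+ A₄ :* X :+ A₆)

  x₀ᴱ y₀ᴱ : Expr
  x₀ᴱ = gen 0
  y₀ᴱ = gen 1

  θxᴱ θyᴱ : MatExpr
  θxᴱ = matᴱ (:- x₀ᴱ :− A₂)                (:- one) zer
             (x₀ᴱ :* x₀ᴱ :+ A₂ :* x₀ᴱ :+ A₄) zer      y₀ᴱ
             (y₀ᴱ :+ A₁ :* x₀ᴱ :+ A₃)        zer      x₀ᴱ
  θyᴱ = matᴱ zer      zer zer
             (:- A₁)  zer (:- one)
             one      zer zer

  module Af where
    open PresentedAlgebra RelA public

    generator : ℕ → T
    generator 0 = gy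
    generator 1 = gx
    generator _ = con 0#

    open MatrixAlgebra RelA public
    open Reified (λ _ → 1) (λ i → con (coefficient i)) (λ i → central-con (coefficient i))
                 generator public

    xᴱ yᴱ : Expr
    xᴱ = gen 1
    yᴱ = gen 0

    relation-α³ relation-α²β relation-αβ² relation-β³ : Expr
    relation-α³  = :- (xᴱ :* xᴱ :* xᴱ) :− A₂ :* (xᴱ :* xᴱ) :− A₄ :* xᴱ :− A₆
    relation-α²β = A₁ :* xᴱ :+ A₃ :− (xᴱ :* xᴱ :* yᴱ :+ xᴱ :* yᴱ :* xᴱ :+ yᴱ :* xᴱ :* xᴱ)
                   :− A₂ :* (xᴱ :* yᴱ :+ yᴱ :* xᴱ) :− A₄ :* yᴱ
    relation-αβ² = one :+ A₁ :* yᴱ :− (xᴱ :* yᴱ :* yᴱ :+ yᴱ :* xᴱ :* yᴱ :+ yᴱ :* yᴱ :* xᴱ)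
                   :− A₂ :* (yᴱ :* yᴱ)
    relation-β³  = :- (yᴱ :* yᴱ :* yᴱ)

    -- Each relation, solved for its leading word (x is the larger letter), is a rewrite rule.
    relationRules : List Rule
    relationRules =
        byRelation (1 ∷ 1 ∷ 1 ∷ []) (:- (A₂ :* (xᴱ :* xᴱ)) :− A₄ :* xᴱ :− A₆) relation-α³ rel-α³ ≡.refl
      ∷ byRelation (1 ∷ 1 ∷ 0 ∷ [])
          (A₁ :* xᴱ :+ A₃ :− (xᴱ :* yᴱ :* xᴱ :+ yᴱ :* xᴱ :* xᴱ) :− A₂ :* (xᴱ :* yᴱ :+ yᴱ :* xᴱ) :− A₄ :* yᴱ)
          relation-α²β rel-α²β ≡.refl
      ∷ byRelation (1 ∷ 0 ∷ 0 ∷ [])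
          (one :+ A₁ :* yᴱ :− (yᴱ :* xᴱ :* yᴱ :+ yᴱ :* yᴱ :* xᴱ) :− A₂ :* (yᴱ :* yᴱ))
          relation-αβ² rel-αβ² ≡.refl
      ∷ byRelation (0 ∷ 0 ∷ 0 ∷ []) zer relation-β³ rel-β³ ≡.refl
      ∷ []
      where
      open import Algebra.Properties.Ring ring using (-0#≈0#)
      byRelation : ∀ w e r → RelA ⟦ r ⟧ → Reduces [] nothing (wordExpr w :− e) (:- r) → Rule
      byRelation w e r rel = ruleFromRelation w e (:- r) (∼-trans (⊝-cong (relation rel)) -0#≈0#)

    ξᴱ : Expr
    ξᴱ = (xᴱ :* yᴱ) :* (xᴱ :* yᴱ) :− (yᴱ :* yᴱ) :* (xᴱ :* xᴱ :+ A₂ :* xᴱ :+ A₄) :− A₁ :* (xᴱ :* yᴱ)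

    Dᴱ : Expr → Expr
    Dᴱ (gen 0)  = :- (yᴱ :* (yᴱ :* xᴱ) :− yᴱ :* xᴱ :* yᴱ)
    Dᴱ (gen 1)  = :- (xᴱ :* yᴱ :* xᴱ :− xᴱ :* (xᴱ :* yᴱ))
    Dᴱ (gen _)  = zer
    Dᴱ (cvar _) = zer
    Dᴱ one      = zer
    Dᴱ zer      = zer
    Dᴱ (a :+ b) = Dᴱ a :+ Dᴱ b
    Dᴱ (a :* b) = Dᴱ a :* b :+ a :* Dᴱ b
    Dᴱ (:- a)   = :- Dᴱ a

    2ηᴱ ηᴱ : Expr
    2ηᴱ = Dᴱ ξᴱ :− A₁ :* ξᴱ :− A₃
    ηᴱ  = ½ᴱ :* 2ηᴱ

    halving : HalvingRule
    halving = record { index = 5 ; halves = con-halves ½-halves }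

  module CoordinateRing where
    open PresentedAlgebra RelF public
    open import Algebra.Properties.Ring ring using (x∙y⁻¹≈ε⇒x≈y)

    x₀y₀-commute : Commute gx gy
    x₀y₀-commute = x∙y⁻¹≈ε⇒x≈y _ _ (relation rel-comm)

    commutative : ∀ s → Central s
    commutative gx      = central-by-generators ∼-refl x₀y₀-commute
    commutative gy      = central-by-generators (∼-sym x₀y₀-commute) ∼-refl
    commutative (con a) = central-con a
    commutative (s ⊕ t) = central-+ (commutative s) (commutative t)
    commutative (s ⊗ t) = central-* (commutative s) (commutative t)
    commutative (⊝ s)   = central-‿ (commutative s)

    coordinate : ℕ → T
    coordinate 0 = gx
    coordinate 1 = gy
    coordinate _ = con 0#

    -- deg x₀ = 2 and deg y₀ = 3 make both rules below decrease the monomial order.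
    weight : ℕ → ℕ
    weight 0 = 2
    weight 1 = 3
    weight _ = 1

    -- cvar 0 … 5 are the coefficients, cvar (6 + n) the n-th extra central element.
    coefficientsThen : List T → ℕ → T
    coefficientsThen ts (suc (suc (suc (suc (suc (suc n)))))) = nth ts n
    coefficientsThen ts n = con (coefficient n)

    module Normaliser (ts : List T) where
      open MatrixAlgebra RelF public
      open Reified weight (coefficientsThen ts) (λ n → commutative _) coordinate public

      rules : List Rule
      rules = rule (1 ∷ 0 ∷ []) (x₀ᴱ :* y₀ᴱ) (∼-sym x₀y₀-commute)
            ∷ ruleFromRelation (1 ∷ 1 ∷ [])
                (:- (A₁ :* x₀ᴱ :* y₀ᴱ) :− A₃ :* y₀ᴱ
                  :+ (x₀ᴱ :* x₀ᴱ :* x₀ᴱ :+ A₂ :* (x₀ᴱ :* x₀ᴱ) :+ A₄ :* x₀ᴱ :+ A₆))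
                (Fᴱ x₀ᴱ y₀ᴱ) (relation rel-F) ≡.refl
            ∷ []

      halving : HalvingRule
      halving = record { index = 5 ; halves = con-halves ½-halves }

module CentralElements {c ℓ} (K : Field c ℓ) (a₁ a₂ a₃ a₄ a₆ : Field.Carrier K)
    (char≢2 : ¬ (Field._≈_ K (WithField.Weierstrass.2# K a₁ a₂ a₃ a₄ a₆) (Field.0# K))) where
  open WithField K
  open Weierstrass a₁ a₂ a₃ a₄ a₆
  open WeierstrassCurve K a₁ a₂ a₃ a₄ a₆ char≢2
  open Af

  ξ-central : Central ξ
  ξ-central = central-by-generators (prove relationRules nothing (ξᴱ :* xᴱ) (xᴱ :* ξᴱ) ≡.refl)
                                    (prove relationRules nothing (ξᴱ :* yᴱ) (yᴱ :* ξᴱ) ≡.refl)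

  η-central : Central (η char≢2)
  η-central = central-* (central-con ½) (central-by-generators
    (prove relationRules nothing (2ηᴱ :* xᴱ) (xᴱ :* 2ηᴱ) ≡.refl)
    (prove relationRules nothing (2ηᴱ :* yᴱ) (yᴱ :* 2ηᴱ) ≡.refl))

  curve-equation : F ξ (η char≢2) ∼⟨ RelA ⟩ con (Field.0# K)
  curve-equation = prove relationRules (just halving) (Fᴱ ξᴱ ηᴱ) zer ≡.refl

  σ : T → T
  σ gx      = ξ
  σ gy      = η char≢2
  σ (con a) = con a
  σ (s ⊕ t) = σ s ⊕ σ t
  σ (s ⊗ t) = σ s ⊗ σ t
  σ (⊝ s)   = ⊝ σ s

  σ-central : ∀ s → Central (σ s)
  σ-central gx      = ξ-central
  σ-central gy      = η-central
  σ-central (con a) = central-con a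
  σ-central (s ⊕ t) = central-+ (σ-central s) (σ-central t)
  σ-central (s ⊗ t) = central-* (σ-central s) (σ-central t)
  σ-central (⊝ s)   = central-‿ (σ-central s)

  σ-respects : ∀ {s t} → s ∼⟨ RelF ⟩ t → σ s ∼⟨ RelA ⟩ σ t
  σ-respects ∼-refl                = ∼-refl
  σ-respects (∼-sym s∼t)           = ∼-sym (σ-respects s∼t)
  σ-respects (∼-trans s∼t t∼u)     = ∼-trans (σ-respects s∼t) (σ-respects t∼u)
  σ-respects (⊕-cong s∼s′ t∼t′)    = ⊕-cong (σ-respects s∼s′) (σ-respects t∼t′)
  σ-respects (⊗-cong s∼s′ t∼t′)    = ⊗-cong (σ-respects s∼s′) (σ-respects t∼t′)
  σ-respects (⊝-cong s∼s′)         = ⊝-cong (σ-respects s∼s′)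
  σ-respects ⊕-assoc               = ⊕-assoc
  σ-respects ⊕-comm                = ⊕-comm
  σ-respects ⊕-idʳ                 = ⊕-idʳ
  σ-respects ⊕-invʳ                = ⊕-invʳ
  σ-respects ⊗-assoc               = ⊗-assoc
  σ-respects ⊗-idˡ                 = ⊗-idˡ
  σ-respects ⊗-idʳ                 = ⊗-idʳ
  σ-respects distribˡ              = distribˡ
  σ-respects distribʳ              = distribʳ
  σ-respects (con-cong a≈b)        = con-cong a≈b
  σ-respects con-+                 = con-+
  σ-respects con-*                 = con-*
  σ-respects con-central           = con-central
  σ-respects (relation rel-comm)   = ∼-trans (⊕-cong (ξ-central (η char≢2)) ∼-refl) ⊕-invʳ
  σ-respects (relation rel-F)      = curve-equation

  σᴱ : Expr → Expr
  σᴱ (gen 0)  = ξᴱ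
  σᴱ (gen 1)  = ηᴱ
  σᴱ (gen _)  = zer
  σᴱ (cvar i) = cvar i
  σᴱ one      = one
  σᴱ zer      = zer
  σᴱ (a :+ b) = σᴱ a :+ σᴱ b
  σᴱ (a :* b) = σᴱ a :* σᴱ b
  σᴱ (:- a)   = :- σᴱ a

module MatrixUnits {c ℓ} (K : Field c ℓ) (a₁ a₂ a₃ a₄ a₆ : Field.Carrier K)
    (char≢2 : ¬ (Field._≈_ K (WithField.Weierstrass.2# K a₁ a₂ a₃ a₄ a₆) (Field.0# K))) where
  open Field K using (1#)
  open WithField K
  open Weierstrass a₁ a₂ a₃ a₄ a₆
  open WeierstrassCurve K a₁ a₂ a₃ a₄ a₆ char≢2
  open Af
  open CentralElements K a₁ a₂ a₃ a₄ a₆ char≢2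

  -- Preimages under θ of the matrix units E₀₀, E₁₀, E₂₀ and E₀₀, E₀₁, E₀₂.
  e₀₀ᴱ : Expr
  e₀₀ᴱ = xᴱ :* (yᴱ :* yᴱ)

  columnUnitᴱ rowUnitᴱ : Fin 3 → Expr
  columnUnitᴱ zero             = e₀₀ᴱ
  columnUnitᴱ (suc zero)       = :- (yᴱ :* yᴱ)
  columnUnitᴱ (suc (suc zero)) = yᴱ :* e₀₀ᴱ :− A₁ :* (yᴱ :* yᴱ)
  rowUnitᴱ zero             = e₀₀ᴱ
  rowUnitᴱ (suc zero)       = e₀₀ᴱ :* (xᴱ :* e₀₀ᴱ) :− e₀₀ᴱ :* xᴱ
  rowUnitᴱ (suc (suc zero)) = :- (rowUnitᴱ (suc zero) :* yᴱ :+ A₁ :* e₀₀ᴱ)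

  e₀₀ : T
  e₀₀ = ⟦ e₀₀ᴱ ⟧

  columnUnit rowUnit : Fin 3 → T
  columnUnit i = ⟦ columnUnitᴱ i ⟧
  rowUnit j    = ⟦ rowUnitᴱ j ⟧

  rowUnit-columnUnit : (λ j k → rowUnit j ⊗ columnUnit k) ≈ᴹ scalarMat e₀₀
  rowUnit-columnUnit = prove-matrix-via relationRules nothing
    (λ j k → rowUnitᴱ j :* columnUnitᴱ k) (scalarᴱ e₀₀ᴱ) ≡.refl ≡.refl ≡.refl

  columnUnit-e₀₀ : ∀ i → columnUnit i ⊗ e₀₀ ∼⟨ RelA ⟩ columnUnit i
  columnUnit-e₀₀ zero             =
    prove relationRules nothing (columnUnitᴱ zero :* e₀₀ᴱ) (columnUnitᴱ zero) ≡.refl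
  columnUnit-e₀₀ (suc zero)       =
    prove relationRules nothing (columnUnitᴱ (suc zero) :* e₀₀ᴱ) (columnUnitᴱ (suc zero)) ≡.refl
  columnUnit-e₀₀ (suc (suc zero)) =
    prove relationRules nothing (columnUnitᴱ (suc (suc zero)) :* e₀₀ᴱ)
                                (columnUnitᴱ (suc (suc zero))) ≡.refl

  units-sum : sum₃ _⊕_ (λ i → columnUnit i ⊗ rowUnit i) ∼⟨ RelA ⟩ con 1#
  units-sum = prove relationRules nothing (sum₃ _:+_ (λ i → columnUnitᴱ i :* rowUnitᴱ i)) one ≡.refl

  conjugate-x : (λ i j → rowUnit i ⊗ (gx ⊗ columnUnit j)) ≈ᴹ (λ i j → σ (θx i j) ⊗ e₀₀)
  conjugate-x = prove-matrix-via relationRules (just halving)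
    (λ i j → rowUnitᴱ i :* (xᴱ :* columnUnitᴱ j)) (λ i j → σᴱ (θxᴱ i j) :* e₀₀ᴱ) ≡.refl ≡.refl ≡.refl

  conjugate-y : (λ i j → rowUnit i ⊗ (gy ⊗ columnUnit j)) ≈ᴹ (λ i j → σ (θy i j) ⊗ e₀₀)
  conjugate-y = prove-matrix-via relationRules nothing
    (λ i j → rowUnitᴱ i :* (yᴱ :* columnUnitᴱ j)) (λ i j → σᴱ (θyᴱ i j) :* e₀₀ᴱ) ≡.refl ≡.refl ≡.refl

module Representation {c ℓ} (K : Field c ℓ) (a₁ a₂ a₃ a₄ a₆ : Field.Carrier K)
    (char≢2 : ¬ (Field._≈_ K (WithField.Weierstrass.2# K a₁ a₂ a₃ a₄ a₆) (Field.0# K))) where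
  open Field K using (0#)
  open WithField K
  open Weierstrass a₁ a₂ a₃ a₄ a₆
  open Presentation K using (unitMat)
  open WeierstrassCurve K a₁ a₂ a₃ a₄ a₆ char≢2
  open Af using (ξᴱ; ηᴱ; relation-α³; relation-α²β; relation-αβ²; relation-β³)
  open CentralElements K a₁ a₂ a₃ a₄ a₆ char≢2 using (σ)
  open MatrixUnits K a₁ a₂ a₃ a₄ a₆ char≢2 using (columnUnit; rowUnit; columnUnitᴱ; rowUnitᴱ)
  open CoordinateRing
  open Normaliser []

  -- θ on expressions over A_f (x = gen 1, y = gen 0); both normalisers read cvar i as
  -- con (coefficient i), so central variables are kept.
  θᴱ : Expr → MatExpr
  θᴱ (gen 0)  = θyᴱ
  θᴱ (gen 1)  = θxᴱ
  θᴱ (gen _)  = scalarᴱ zer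
  θᴱ (cvar i) = scalarᴱ (cvar i)
  θᴱ one      = scalarᴱ one
  θᴱ zer      = scalarᴱ zer
  θᴱ (a :+ b) = θᴱ a M+ᴱ θᴱ b
  θᴱ (a :* b) = θᴱ a M*ᴱ θᴱ b
  θᴱ (:- a)   = M-ᴱ θᴱ a

  θ-relation : ∀ {r} → RelA r → θ r ≈ᴹ scalarMat (con 0#)
  θ-relation rel-α³  = prove-matrix-via rules nothing (θᴱ relation-α³) (scalarᴱ zer)
    ≡.refl ≡.refl ≡.refl
  θ-relation rel-α²β = prove-matrix-via rules nothing (θᴱ relation-α²β) (scalarᴱ zer)
    ≡.refl ≡.refl ≡.refl
  θ-relation rel-αβ² = prove-matrix-via rules nothing (θᴱ relation-αβ²) (scalarᴱ zer)
    ≡.refl ≡.refl ≡.refl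
  θ-relation rel-β³  = prove-matrix-via rules nothing (θᴱ relation-β³) (scalarᴱ zer)
    ≡.refl ≡.refl ≡.refl

  θ-respects : ∀ {s t} → s ∼⟨ RelA ⟩ t → θ s ≈ᴹ θ t
  θ-respects ∼-refl                          = ≈ᴹ-refl
  θ-respects (∼-sym s∼t)                     = ≈ᴹ-sym (θ-respects s∼t)
  θ-respects (∼-trans s∼t t∼u)               = ≈ᴹ-trans (θ-respects s∼t) (θ-respects t∼u)
  θ-respects (⊕-cong s∼s′ t∼t′)              = M+-cong (θ-respects s∼s′) (θ-respects t∼t′)
  θ-respects (⊗-cong s∼s′ t∼t′)              = M*-cong (θ-respects s∼s′) (θ-respects t∼t′)
  θ-respects (⊝-cong s∼s′)                   = M--cong (θ-respects s∼s′)
  θ-respects ⊕-assoc                         = λ i j → ⊕-assoc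
  θ-respects ⊕-comm                          = λ i j → ⊕-comm
  θ-respects ⊕-idʳ                           = ≈ᴹ-trans (M+-cong ≈ᴹ-refl scalarMat-zero) (λ i j → ⊕-idʳ)
  θ-respects ⊕-invʳ                          = ≈ᴹ-trans (λ i j → ⊕-invʳ) (≈ᴹ-sym scalarMat-zero)
  θ-respects (⊗-assoc {s} {t} {u})           = Laws.M*-assoc (θ s) (θ t) (θ u)
  θ-respects (⊗-idˡ {t})                     = M*-identityˡ (θ t)
  θ-respects (⊗-idʳ {t})                     = M*-identityʳ (θ t)
  θ-respects (distribˡ {s} {t} {u})          = Laws.M*-distribˡ (θ s) (θ t) (θ u)
  θ-respects (distribʳ {s} {t} {u})          = Laws.M*-distribʳ (θ s) (θ t) (θ u)
  θ-respects (con-cong a≈b)                  = scalarMat-cong (con-cong a≈b)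
  θ-respects con-+                           = ≈ᴹ-trans (scalarMat-cong con-+) (scalarMat-homo-+ _ _)
  θ-respects con-*                           = ≈ᴹ-trans (scalarMat-cong con-*) (scalarMat-homo-* _ _)
  θ-respects (con-central {a} {t})           = scalarMat-con-central a (θ t)
  θ-respects (relation r)                    = θ-relation r

  θξ : θ ξ ≈ᴹ scalarMat x₀
  θξ = prove-matrix-via rules nothing (θᴱ ξᴱ) (scalarᴱ x₀ᴱ) ≡.refl ≡.refl ≡.refl

  θη : θ (η char≢2) ≈ᴹ scalarMat y₀
  θη = prove-matrix-via rules (just halving) (θᴱ ηᴱ) (scalarᴱ y₀ᴱ) ≡.refl ≡.refl ≡.refl

  θσ : ∀ m → θ (σ m) ≈ᴹ scalarMat m
  θσ gx      = θξ
  θσ gy      = θη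
  θσ (con a) = ≈ᴹ-refl
  θσ (s ⊕ t) = ≈ᴹ-trans (M+-cong (θσ s) (θσ t)) (≈ᴹ-sym (scalarMat-homo-+ s t))
  θσ (s ⊗ t) = ≈ᴹ-trans (M*-cong (θσ s) (θσ t)) (≈ᴹ-sym (scalarMat-homo-* s t))
  θσ (⊝ s)   = ≈ᴹ-trans (M--cong (θσ s)) (≈ᴹ-sym (scalarMat-homo-‿ s))

  θ-columnUnit : ∀ i → θ (columnUnit i) ≈ᴹ unitMat i zero
  θ-columnUnit zero             = prove-matrix-via rules nothing
    (θᴱ (columnUnitᴱ zero)) (unitᴱ zero zero) ≡.refl ≡.refl ≡.refl
  θ-columnUnit (suc zero)       = prove-matrix-via rules nothing
    (θᴱ (columnUnitᴱ (suc zero))) (unitᴱ (suc zero) zero) ≡.refl ≡.refl ≡.refl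
  θ-columnUnit (suc (suc zero)) = prove-matrix-via rules nothing
    (θᴱ (columnUnitᴱ (suc (suc zero)))) (unitᴱ (suc (suc zero)) zero) ≡.refl ≡.refl ≡.refl

  θ-rowUnit : ∀ j → θ (rowUnit j) ≈ᴹ unitMat zero j
  θ-rowUnit zero             = prove-matrix-via rules nothing
    (θᴱ (rowUnitᴱ zero)) (unitᴱ zero zero) ≡.refl ≡.refl ≡.refl
  θ-rowUnit (suc zero)       = prove-matrix-via rules nothing
    (θᴱ (rowUnitᴱ (suc zero))) (unitᴱ zero (suc zero)) ≡.refl ≡.refl ≡.refl
  θ-rowUnit (suc (suc zero)) = prove-matrix-via rules nothing
    (θᴱ (rowUnitᴱ (suc (suc zero)))) (unitᴱ zero (suc (suc zero))) ≡.refl ≡.refl ≡.refl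

module Inverse {c ℓ} (K : Field c ℓ) (a₁ a₂ a₃ a₄ a₆ : Field.Carrier K)
    (char≢2 : ¬ (Field._≈_ K (WithField.Weierstrass.2# K a₁ a₂ a₃ a₄ a₆) (Field.0# K))) where
  open WithField K
  open Weierstrass a₁ a₂ a₃ a₄ a₆
  open Presentation K using (nth; entries; unitMat)
  open WeierstrassCurve K a₁ a₂ a₃ a₄ a₆ char≢2
  open CentralElements K a₁ a₂ a₃ a₄ a₆ char≢2 using (σ; σ-central; σ-respects)
  open MatrixUnits K a₁ a₂ a₃ a₄ a₆ char≢2
  module A = Af
  module F = CoordinateRing

  ψ-term : Mat → Fin 3 → Fin 3 → T
  ψ-term M i j = σ (M i j) ⊗ (columnUnit i ⊗ rowUnit j)

  ψ : Mat → T
  ψ M = sum₃ₓ₃ _⊕_ (ψ-term M)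

  ψ-cong : ∀ {A B} → A ≈M⟨ RelF ⟩ B → ψ A ∼⟨ RelA ⟩ ψ B
  ψ-cong {A} {B} A≈B = sum₃ₓ₃-cong {_≈_ = _∼⟨ RelA ⟩_} _⊕_ ⊕-cong {ψ-term A} {ψ-term B}
    (λ i j → ⊗-cong (σ-respects (A≈B i j)) ∼-refl)

  columnIndex rowIndex : Fin 3 → ℕ
  columnIndex i       = toℕ i
  rowIndex zero    = 0
  rowIndex (suc j) = 3 ℕ.+ toℕ j

  unitOrGenerator : ℕ → T
  unitOrGenerator 0 = columnUnit zero
  unitOrGenerator 1 = columnUnit (suc zero)
  unitOrGenerator 2 = columnUnit (suc (suc zero))
  unitOrGenerator 3 = rowUnit (suc zero)
  unitOrGenerator 4 = rowUnit (suc (suc zero))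
  unitOrGenerator 5 = gx
  unitOrGenerator 6 = gy
  unitOrGenerator _ = con (Field.0# K)

  module Normaliser (ts : List T) where
    open A.Reified (λ _ → 1) (λ n → σ (nth ts n)) (λ n → σ-central (nth ts n)) unitOrGenerator public

    ψᴱ : MatExpr → Expr
    ψᴱ M = sum₃ₓ₃ _:+_ (λ i j → M i j :* (gen (columnIndex i) :* gen (rowIndex j)))

    unitSumᴱ : Expr
    unitSumᴱ = sum₃ _:+_ (λ i → gen (columnIndex i) :* gen (rowIndex i))

    unitRules : List Rule
    unitRules =
      matrixRules (λ j k → rowIndex j ∷ columnIndex k ∷ []) (scalarᴱ (gen 0))
        (A.≈ᴹ-trans (A.≈ᴹ-entrywise ≡.refl) (A.≈ᴹ-trans rowUnit-columnUnit (A.≈ᴹ-entrywise ≡.refl)))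
      ++ rule (1 ∷ 0 ∷ []) (gen 1) (columnUnit-e₀₀ (suc zero))
       ∷ rule (2 ∷ 0 ∷ []) (gen 2) (columnUnit-e₀₀ (suc (suc zero)))
       ∷ []

  ψ-homo-+ : ∀ A B → ψ (A M+ B) ∼⟨ RelA ⟩ ψ A ⊕ ψ B
  ψ-homo-+ A B = prove [] nothing (ψᴱ (variableMatrix cvar 0 M+ᴱ variableMatrix cvar 9))
                                   (ψᴱ (variableMatrix cvar 0) :+ ψᴱ (variableMatrix cvar 9)) ≡.refl
    where open Normaliser (entries A ++ entries B)

  ψ-homo-‿ : ∀ A → ψ (M- A) ∼⟨ RelA ⟩ ⊝ ψ A
  ψ-homo-‿ A = prove [] nothing (ψᴱ (M-ᴱ variableMatrix cvar 0)) (:- ψᴱ (variableMatrix cvar 0)) ≡.refl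
    where open Normaliser (entries A)

  ψ-homo-* : ∀ A B → ψ (A M* B) ∼⟨ RelA ⟩ ψ A ⊗ ψ B
  ψ-homo-* A B = prove unitRules nothing (ψᴱ (variableMatrix cvar 0 M*ᴱ variableMatrix cvar 9))
                                         (ψᴱ (variableMatrix cvar 0) :* ψᴱ (variableMatrix cvar 9)) ≡.refl
    where open Normaliser (entries A ++ entries B)

  ψ-scalar : ∀ a → ψ (scalarMat (con a)) ∼⟨ RelA ⟩ con a
  ψ-scalar a = ∼-trans (prove [] nothing (ψᴱ (scalarᴱ (cvar 0))) (cvar 0 :* unitSumᴱ) ≡.refl)
                       (∼-trans (⊗-cong ∼-refl units-sum) ⊗-idʳ)
    where open Normaliser (con a ∷ [])

  -- x = (Σᵢ eᵢ₀ e₀ᵢ) x (Σⱼ eⱼ₀ e₀ⱼ), and e₀ᵢ x eⱼ₀ = σ(θ(x)ᵢⱼ) e₀₀.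
  ψ-θx : ψ θx ∼⟨ RelA ⟩ gx
  ψ-θx = ∼-sym (∼-trans sandwich (prove (conjugationRules ++ unitRules) nothing
                                         (unitSumᴱ :* (gen 5 :* unitSumᴱ)) (ψᴱ (variableMatrix cvar 0)) ≡.refl))
    where
    open Normaliser (entries θx)
    sandwich : gx ∼⟨ RelA ⟩ ⟦ unitSumᴱ ⟧ ⊗ (gx ⊗ ⟦ unitSumᴱ ⟧)
    sandwich = ∼-sym (∼-trans (⊗-cong units-sum (⊗-cong ∼-refl units-sum)) (∼-trans ⊗-idˡ ⊗-idʳ))
    conjugationRules : List Rule
    conjugationRules = matrixRules (λ i j → rowIndex i ∷ 5 ∷ columnIndex j ∷ [])
      (λ i j → cvar (entryIndex i j) :* gen 0)
      (A.≈ᴹ-trans (A.≈ᴹ-entrywise ≡.refl) (A.≈ᴹ-trans conjugate-x (A.≈ᴹ-entrywise ≡.refl)))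

  ψ-θy : ψ θy ∼⟨ RelA ⟩ gy
  ψ-θy = ∼-sym (∼-trans sandwich (prove (conjugationRules ++ unitRules) nothing
                                         (unitSumᴱ :* (gen 6 :* unitSumᴱ)) (ψᴱ (variableMatrix cvar 0)) ≡.refl))
    where
    open Normaliser (entries θy)
    sandwich : gy ∼⟨ RelA ⟩ ⟦ unitSumᴱ ⟧ ⊗ (gy ⊗ ⟦ unitSumᴱ ⟧)
    sandwich = ∼-sym (∼-trans (⊗-cong units-sum (⊗-cong ∼-refl units-sum)) (∼-trans ⊗-idˡ ⊗-idʳ))
    conjugationRules : List Rule
    conjugationRules = matrixRules (λ i j → rowIndex i ∷ 6 ∷ columnIndex j ∷ [])
      (λ i j → cvar (entryIndex i j) :* gen 0)
      (A.≈ᴹ-trans (A.≈ᴹ-entrywise ≡.refl) (A.≈ᴹ-trans conjugate-y (A.≈ᴹ-entrywise ≡.refl)))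

  ψθ : ∀ s → ψ (θ s) ∼⟨ RelA ⟩ s
  ψθ gx      = ψ-θx
  ψθ gy      = ψ-θy
  ψθ (con a) = ψ-scalar a
  ψθ (s ⊕ t) = ∼-trans (ψ-homo-+ (θ s) (θ t)) (⊕-cong (ψθ s) (ψθ t))
  ψθ (s ⊗ t) = ∼-trans (ψ-homo-* (θ s) (θ t)) (⊗-cong (ψθ s) (ψθ t))
  ψθ (⊝ s)   = ∼-trans (ψ-homo-‿ (θ s)) (⊝-cong (ψθ s))

  θψ : ∀ M → θ (ψ M) ≈M⟨ RelF ⟩ M
  θψ M = ≈ᴹ-trans
    (sum₃ₓ₃-cong {_≈_ = _≈ᴹ_} _M+_ M+-cong
      {λ i j → θ (σ (M i j)) M* (θ (columnUnit i) M* θ (rowUnit j))}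
      {λ i j → scalarMat (M i j) M* (unitMat i zero M* unitMat zero j)}
      (λ i j → M*-cong (θσ (M i j)) (M*-cong (θ-columnUnit i) (θ-rowUnit j))))
    (prove-matrix-via rules nothing
      (sum₃ₓ₃ _M+ᴱ_ (λ i j → scalarᴱ (cvar (6 ℕ.+ entryIndex i j)) M*ᴱ (unitᴱ i zero M*ᴱ unitᴱ zero j)))
      (variableMatrix cvar 6) ≡.refl ≡.refl ≡.refl)
    where
    open F.Normaliser (entries M)
    open Representation K a₁ a₂ a₃ a₄ a₆ char≢2 using (θσ; θ-columnUnit; θ-rowUnit)

  θ-injective : ∀ s t → θ s ≈M⟨ RelF ⟩ θ t → s ∼⟨ RelA ⟩ t
  θ-injective s t θs≈θt = ∼-trans (∼-sym (ψθ s)) (∼-trans (ψ-cong θs≈θt) (ψθ t))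

lemma5p3 : ∀ {c ℓ} (K : Field c ℓ) →
    let open Field K
        open WithField K
    in (a₁ a₂ a₃ a₄ a₆ : Carrier) →
       let open Weierstrass a₁ a₂ a₃ a₄ a₆
       in (char≢2 : ¬ (2# ≈ 0#)) → (char≢3 : ¬ (3# ≈ 0#)) → Smooth →
          IsIsoθ × (θ ξ ≈M scalarMat x₀) × (θ (η char≢2) ≈M scalarMat y₀)
lemma5p3 K a₁ a₂ a₃ a₄ a₆ char≢2 _ _ =
  ((λ _ _ → θ-respects) , θ-injective , (λ M → ψ M , θψ M)) , θξ , θη
  where
  open Representation K a₁ a₂ a₃ a₄ a₆ char≢2 using (θ-respects; θξ; θη)
  open Inverse K a₁ a₂ a₃ a₄ a₆ char≢2 using (ψ; θψ; θ-injective)
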